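{- The category $\mathsf{SContFCov}$ of strong continuous finitary covers and join-approximable maps is equivalent to the category $\mathsf{ContBCov}$ of continuous basic covers and basic cover maps. This equivalence restricts to an equivalence between the category $\mathsf{LSContFCov}$ of localized strong continuous finitary covers and proximity maps and the category $\mathsf{LKFTop}$ of locally compact formal topologies and formal topology maps.
   Context: Work constructively; $\mathrm{Fin}(S)$ = finitely enumerable subsets, $\mathcal P(S)$ = subsets; for $r\subseteq X\times Y$, $r^-V=\{x\mid\exists y\in V\,(x\,r\,y)\}$, $r^-y=r^-\{y\}$. Finitary cover: $(S,\blacktriangleleft)$, $\blacktriangleleft\subseteq S\times\mathrm{Fin}(S)$ with $a\in A\Rightarrow a\blacktriangleleft A$; $a\blacktriangleleft A\Rightarrow a\blacktriangleleft A\cup B$; $a\blacktriangleleft A\cup\{b\}\ \&\ b\blacktriangleleft A\Rightarrow a\blacktriangleleft A$. Strong continuous finitary cover: $(S,\blacktriangleleft,\sqsubset)$, $\sqsubset$ idempotent on $S$, with $\exists b\,(a\sqsubset b\blacktriangleleft A)\iff\exists B\,(a\blacktriangleleft B\ \&\ \forall b\in B\,\exists c\in A\,(b\sqsubset c))$; $a\ll_\blacktriangleleft A\iff\exists b\,(a\sqsubset b\blacktriangleleft A)$. Localized: $b\sqsubset a\blacktriangleleft A\Rightarrow\exists B\in\mathrm{Fin}(\{c\mid c\sqsubset a\ \&\ \exists a'\in A\,(c\sqsubset a')\})\,(b\blacktriangleleft B)$. Cut composition: $a\,(s\cdot r)\,C\iff\exists B\,(a\,r\,B\ \&\ \forall b\in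 B\,(b\,s\,C))$. A join-approximable map $(S,\blacktriangleleft,\sqsubset)\to(S',\blacktriangleleft',\sqsubset')$ is $r\subseteq S\times\mathrm{Fin}(S')$ with $r\cdot\ll_\blacktriangleleft=r=\ll_{\blacktriangleleft'}\cdot r$ and $a\,r\,B\Rightarrow\exists A\,(a\blacktriangleleft A\ \&\ \forall a'\in A\,\exists b\in B\,(a'\,r\,\{b\}))$. It is Lawson approximable if (i) $a\sqsubset a'\Rightarrow\exists B\,(a\,r\,B)$ and (ii) $a\sqsubset a'\ \&\ a'\,r\,B\ \&\ a'\,r\,C\Rightarrow\exists D\,(\forall d\in D\,(d\ll_{\blacktriangleleft'}B\ \&\ d\ll_{\blacktriangleleft'}C)\ \&\ a\,r\,D)$. A proximity map is a join-approximable Lawson approximable map between localized ones. In both categories, identity is $\ll_\blacktriangleleft$ and composition is cut composition. Basic cover: $(S,\lhd)$, $\lhd\subseteq S\times\mathcal P(S)$, $a\in U\Rightarrow a\lhd U$, and $a\lhd U\ \&\ \forall u\in U\,(u\lhd V)\Rightarrow a\lhd V$. It is continuous if there is $\mathsf{wb}\subseteq S\times S$ with $a\lhd\mathsf{wb}^-a$ for all $a$ and $b\,\mathsf{wb}\,a\ \&\ a\lhd U\Rightarrow\exists A\in\mathrm{Fin}(U)\,(b\lhd A)$. A basic cover map $(S,\lhd)\to(S',\lhd')$ is $r\subseteq S\times S'$ with $a\lhd r^-b\Rightarrow a\,r\,b$ and $b\lhd'V\Rightarrow\forall a\in r^-b\,(a\lhd r^-V)$. In $\mathsf{BCov}$,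 identity is $a\lhd\{b\}$ and composition is $a\,(s*r)\,c\iff a\lhd r^-s^-c$; $\mathsf{ContBCov}$ is its full subcategory of continuous basic covers. Formal topology: $(S,\lhd,\le)$ with $(S,\lhd)$ a basic cover, $\le$ a preorder, $a\le b\Rightarrow a\lhd\{b\}$, $a\lhd U\ \&\ a\lhd V\Rightarrow a\lhd\downarrow_\le U\cap\downarrow_\le V$. A formal topology map is a basic cover map with $\forall a\in S\,(a\lhd r^-S')$ and $\forall x\in\downarrow_\le r^-a\cap\downarrow_\le r^-b\,(x\lhd r^-(\downarrow_{\le'}a\cap\downarrow_{\le'}b))$. $\mathsf{LKFTop}$: formal topologies whose basic cover is continuous, with formal topology maps. -}

module Defs where

open import Level using (Lift; lift; lower)
open import Data.Unit using (⊤)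
open import Data.List using (List; []; _∷_; [_])
open import Data.List.Membership.Propositional using (_∈_)
open import Data.List.Relation.Binary.Subset.Propositional using (_⊆_)
open import Data.List.Relation.Unary.All using (All)
open import Data.Product using (Σ; _×_; _,_; proj₁; proj₂)
open import Relation.Binary.PropositionalEquality using (_≡_)

_iff_ : Set → Set → Set
A iff B = (A → B) × (B → A)

-- Finitely enumerable subsets Fin(S) are represented by lists; a list A
-- stands for the subset {x | x ∈ A}.

record SCFC : Set₁ where
  field
    S    : Set
    _◀_  : S → List S → Set
    _⊏_  : S → S → Set
    -- finitary cover axioms (A ∪ B ranges over finite supersets of A)
    ◀-refl : ∀ {a A} → a ∈ A → a ◀ A
    ◀-mono : ∀ {a A B} → a ◀ A → A ⊆ B → a ◀ B
    ◀-cut  : ∀ {a b A} → a ◀ (b ∷ A) → b ◀ A → a ◀ A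
    ⊏-idem₁ : ∀ {a c} → a ⊏ c → Σ S (λ b → a ⊏ b × b ⊏ c)
    ⊏-idem₂ : ∀ {a b c} → a ⊏ b → b ⊏ c → a ⊏ c
    strong : ∀ a A →
      (Σ S (λ b → a ⊏ b × b ◀ A)) iff
      (Σ (List S) (λ B → a ◀ B × (∀ b → b ∈ B → Σ S (λ c → c ∈ A × b ⊏ c))))

open SCFC

≪ : (X : SCFC) → S X → List (S X) → Set
≪ X a A = Σ (S X) (λ b → _⊏_ X a b × _◀_ X b A)

Localized : SCFC → Set
Localized X = ∀ {a b A} → _⊏_ X b a → _◀_ X a A →
  Σ (List (S X)) (λ B →
    All (λ c → _⊏_ X c a × Σ (S X) (λ a' → a' ∈ A × _⊏_ X c a')) B
    × _◀_ X b B)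

FRel : SCFC → SCFC → Set₁
FRel X Y = S X → List (S Y) → Set

_·_ : ∀ {X Y Z} → FRel Y Z → FRel X Y → FRel X Z
_·_ {Y = Y} s r a C = Σ (List (S Y)) (λ B → r a B × (∀ b → b ∈ B → s b C))

_≈F_ : ∀ {X Y} → FRel X Y → FRel X Y → Set
_≈F_ {X} {Y} r r' = ∀ (a : S X) (C : List (S Y)) → r a C iff r' a C

IsJoinApprox : (X Y : SCFC) → FRel X Y → Set
IsJoinApprox X Y r =
  _≈F_ {X} {Y} (_·_ {X} {X} {Y} r (≪ X)) r
  × _≈F_ {X} {Y} (_·_ {X} {Y} {Y} (≪ Y) r) r
  × (∀ a B → r a B → Σ (List (S X)) (λ A → _◀_ X a A
        × (∀ a' → a' ∈ A → Σ (S Y) (λ b → b ∈ B × r a' [ b ]))))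

IsLawson : (X Y : SCFC) → FRel X Y → Set
IsLawson X Y r =
  (∀ a a' → _⊏_ X a a' → Σ (List (S Y)) (λ B → r a B))
  × (∀ a a' B C → _⊏_ X a a' → r a' B → r a' C →
       Σ (List (S Y)) (λ D → (∀ d → d ∈ D → ≪ Y d B × ≪ Y d C) × r a D))

record BCov : Set₁ where
  field
    S    : Set
    _◁_  : S → (S → Set) → Set
    ◁-refl  : ∀ {a U} → U a → a ◁ U
    ◁-trans : ∀ {a U V} → a ◁ U → (∀ u → U u → u ◁ V) → a ◁ V

open BCov

IsContinuous : BCov → Set₁
IsContinuous X =
  Σ (S X → S X → Set) (λ wb →
    (∀ a → _◁_ X a (λ x → wb x a))
    × (∀ a b U → wb b a → _◁_ X a U →
         Σ (List (S X)) (λ A → All U A × _◁_ X b (λ x → x ∈ A))))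

record CBC : Set₁ where
  field
    bcov : BCov
    cont : IsContinuous bcov

open CBC

BRel : BCov → BCov → Set₁
BRel X Y = S X → S Y → Set

pre : ∀ {A B : Set} → (A → B → Set) → (B → Set) → A → Set
pre {B = B} r V x = Σ B (λ y → V y × r x y)

IsBCMap : (X Y : BCov) → BRel X Y → Set₁
IsBCMap X Y r =
  (∀ a b → _◁_ X a (λ x → r x b) → r a b)
  × (∀ b V → _◁_ Y b V → ∀ a → r a b → _◁_ X a (pre r V))

idB : (X : BCov) → BRel X X
idB X a b = _◁_ X a (λ x → x ≡ b)

_*_ : ∀ {X Y Z} → BRel Y Z → BRel X Y → BRel X Z
_*_ {X} s r a c = _◁_ X a (pre r (λ y → s y c))

_≈B_ : ∀ {X Y} → BRel X Y → BRel X Y → Set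
_≈B_ {X} {Y} r r' = ∀ (a : S X) (b : S Y) → r a b iff r' a b

record FTop : Set₁ where
  field
    bcov : BCov
    _≤_  : S bcov → S bcov → Set
    ≤-refl  : ∀ {a} → a ≤ a
    ≤-trans : ∀ {a b c} → a ≤ b → b ≤ c → a ≤ c
    ≤⇒◁    : ∀ {a b} → a ≤ b → _◁_ bcov a (λ x → x ≡ b)
    ◁-meet  : ∀ {a U V} → _◁_ bcov a U → _◁_ bcov a V →
      _◁_ bcov a (λ x → Σ (S bcov) (λ u → U u × x ≤ u)
                      × Σ (S bcov) (λ v → V v × x ≤ v))

down : (X : FTop) → (S (FTop.bcov X) → Set) → S (FTop.bcov X) → Set
down X U x = Σ (S (FTop.bcov X)) (λ u → U u × FTop._≤_ X x u)

record LKFT : Set₁ where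
  field
    ftop : FTop
    cont : IsContinuous (FTop.bcov ftop)

IsFTMap : (X Y : FTop) → BRel (FTop.bcov X) (FTop.bcov Y) → Set₁
IsFTMap X Y r =
  IsBCMap (FTop.bcov X) (FTop.bcov Y) r
  × (∀ a → _◁_ (FTop.bcov X) a (pre r (λ _ → ⊤)))
  × (∀ a b x → down X (λ u → r u a) x → down X (λ u → r u b) x →
       _◁_ (FTop.bcov X) x
         (pre r (λ y → down Y (λ z → z ≡ a) y × down Y (λ z → z ≡ b) y)))

-- Categories (data only; the category laws are not part of the record,
-- morphisms are "raw" relations satisfying IsHom, hom-equality is ≈).

record Cat : Set₂ where
  field
    Obj   : Set₁
    Rel   : Obj → Obj → Set₁
    IsHom : ∀ {X Y} → Rel X Y → Set₁
    _≈_   : ∀ {X Y} → Rel X Y → Rel X Y → Set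
    idR   : ∀ X → Rel X X
    _∘R_  : ∀ {X Y Z} → Rel Y Z → Rel X Y → Rel X Z

record Functor (C D : Cat) : Set₂ where
  private
    module C = Cat C
    module D = Cat D
  field
    F₀ : C.Obj → D.Obj
    F₁ : ∀ {X Y} (r : C.Rel X Y) → C.IsHom r → D.Rel (F₀ X) (F₀ Y)
    F-hom  : ∀ {X Y} (r : C.Rel X Y) (p : C.IsHom r) → D.IsHom (F₁ r p)
    F-resp : ∀ {X Y} {r r' : C.Rel X Y} (p : C.IsHom r) (p' : C.IsHom r') →
      r C.≈ r' → F₁ r p D.≈ F₁ r' p'
    F-id   : ∀ X (p : C.IsHom (C.idR X)) → F₁ (C.idR X) p D.≈ D.idR (F₀ X)
    F-∘    : ∀ {X Y Z} (r : C.Rel X Y) (s : C.Rel Y Z)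
      (p : C.IsHom r) (q : C.IsHom s) (pq : C.IsHom (s C.∘R r)) →
      F₁ (s C.∘R r) pq D.≈ (F₁ s q D.∘R F₁ r p)

record NatIso (C D : Cat)
  (F₀ G₀ : Cat.Obj C → Cat.Obj D)
  (F₁ : ∀ {X Y} (r : Cat.Rel C X Y) → Cat.IsHom C r → Cat.Rel D (F₀ X) (F₀ Y))
  (G₁ : ∀ {X Y} (r : Cat.Rel C X Y) → Cat.IsHom C r → Cat.Rel D (G₀ X) (G₀ Y))
  : Set₂ where
  private
    module C = Cat C
    module D = Cat D
  field
    α     : ∀ X → D.Rel (F₀ X) (G₀ X)
    α-hom : ∀ X → D.IsHom (α X)
    β     : ∀ X → D.Rel (G₀ X) (F₀ X)
    β-hom : ∀ X → D.IsHom (β X)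
    βα    : ∀ X → (β X D.∘R α X) D.≈ D.idR (F₀ X)
    αβ    : ∀ X → (α X D.∘R β X) D.≈ D.idR (G₀ X)
    nat   : ∀ {X Y} (r : C.Rel X Y) (p : C.IsHom r) →
      (α Y D.∘R F₁ r p) D.≈ (G₁ r p D.∘R α X)

record Equivalence (C D : Cat) : Set₂ where
  field
    F : Functor C D
    G : Functor D C
  open Functor F renaming (F₀ to F0; F₁ to F1; F-hom to Fh)
  open Functor G renaming (F₀ to G0; F₁ to G1; F-hom to Gh)
  field
    η : NatIso C C (λ X → X) (λ X → G0 (F0 X))
          (λ r p → r) (λ r p → G1 (F1 r p) (Fh r p))
    ε : NatIso D D (λ X → F0 (G0 X)) (λ X → X)
          (λ r p → F1 (G1 r p) (Gh r p)) (λ r p → r)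

SContFCov : Cat
SContFCov = record
  { Obj   = SCFC
  ; Rel   = FRel
  ; IsHom = λ {X} {Y} r → Lift _ (IsJoinApprox X Y r)
  ; _≈_   = λ {X} {Y} r r' → _≈F_ {X} {Y} r r'
  ; idR   = ≪
  ; _∘R_  = λ {X} {Y} {Z} s r → _·_ {X} {Y} {Z} s r
  }

LSCFC : Set₁
LSCFC = Σ SCFC Localized

LSContFCov : Cat
LSContFCov = record
  { Obj   = LSCFC
  ; Rel   = λ X Y → FRel (proj₁ X) (proj₁ Y)
  ; IsHom = λ {X} {Y} r → Lift _ (IsJoinApprox (proj₁ X) (proj₁ Y) r
                                  × IsLawson (proj₁ X) (proj₁ Y) r)
  ; _≈_   = λ {X} {Y} r r' → _≈F_ {proj₁ X} {proj₁ Y} r r'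
  ; idR   = λ X → ≪ (proj₁ X)
  ; _∘R_  = λ {X} {Y} {Z} s r → _·_ {proj₁ X} {proj₁ Y} {proj₁ Z} s r
  }

ContBCov : Cat
ContBCov = record
  { Obj   = CBC
  ; Rel   = λ X Y → BRel (bcov X) (bcov Y)
  ; IsHom = λ {X} {Y} r → IsBCMap (bcov X) (bcov Y) r
  ; _≈_   = λ {X} {Y} r r' → _≈B_ {bcov X} {bcov Y} r r'
  ; idR   = λ X → idB (bcov X)
  ; _∘R_  = λ {X} {Y} {Z} s r → _*_ {bcov X} {bcov Y} {bcov Z} s r
  }

LKFTop : Cat
LKFTop = record
  { Obj   = LKFT
  ; Rel   = λ X Y → BRel (FTop.bcov (LKFT.ftop X)) (FTop.bcov (LKFT.ftop Y))
  ; IsHom = λ {X} {Y} r → IsFTMap (LKFT.ftop X) (LKFT.ftop Y) r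
  ; _≈_   = λ {X} {Y} r r' →
      _≈B_ {FTop.bcov (LKFT.ftop X)} {FTop.bcov (LKFT.ftop Y)} r r'
  ; idR   = λ X → idB (FTop.bcov (LKFT.ftop X))
  ; _∘R_  = λ {X} {Y} {Z} s r →
      _*_ {FTop.bcov (LKFT.ftop X)} {FTop.bcov (LKFT.ftop Y)}
          {FTop.bcov (LKFT.ftop Z)} s r
  }

-- inclusion LSContFCov → SContFCov and forgetful LKFTop → ContBCov
-- (identity on relations)
incl₀ : LSCFC → SCFC
incl₀ = proj₁

forget₀ : LKFT → CBC
forget₀ X = record { bcov = FTop.bcov (LKFT.ftop X) ; cont = LKFT.cont X }

-- "E₁ restricts to E₂": the functors of E₂ agree, up to natural
-- isomorphism, with those of E₁ along the inclusion / forgetful functors.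
Restricts : Equivalence SContFCov ContBCov →
            Equivalence LSContFCov LKFTop → Set₂
Restricts E₁ E₂ =
  NatIso LSContFCov ContBCov
    (λ X → forget₀ (F₀ Fb X)) (λ X → F₀ Fa (incl₀ X))
    (λ r p → F₁ Fb r p) (λ r p → F₁ Fa r (lift (proj₁ (lower p))))
  × NatIso LKFTop SContFCov
    (λ Y → incl₀ (F₀ Gb Y)) (λ Y → F₀ Ga (forget₀ Y))
    (λ r p → F₁ Gb r p) (λ r p → F₁ Ga r (proj₁ p))
  where
  open Functor
  Fa = Equivalence.F E₁
  Ga = Equivalence.G E₁
  Fb = Equivalence.F E₂
  Gb = Equivalence.G E₂

-- A strong continuous finitary cover (S, ◀, ⊏) yields the basic cover on S in which a ◁ U holds when
-- every b ⊏ a is way below some finite part of U; ⊏ itself then witnesses continuity. Conversely a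
-- continuous basic cover yields a finitary cover on finite lists, where A ◀ 𝓐 means A ◁ ⋃ 𝓐 and
-- A ⋐ U (the new ⊏) means that A is covered by finitely many points, each way below a point covered
-- by U; continuity makes every cover of such an A finitary, which gives strong continuity. Maps go
-- to a ↦ {b | a ◁ r⁻[b]} and A ↦ {𝓑 | A ⋐ r⁻(⋃ 𝓑)}. The unit relates a to the 𝓑 with a ⊏ a' ◁ ⋃ 𝓑
-- for some a', the counit relates a list A to the points y with A ◁ {y}. For localized covers,
-- a ≤ b :⇔ a ◁ {b} turns the basic cover into a formal topology, because covers way below two lists
-- can be refined to a common one; Lawson approximability is what makes maps preserve these meets.

module Submission where

open import Level using (lift; lower)
open import Data.Unit using (⊤; tt)
open import Data.List using (List; []; _∷_; [_]; _++_; map; concat)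
open import Data.List.Membership.Propositional using (_∈_; mapWith∈)
open import Data.List.Membership.Propositional.Properties
  using (∈-++⁺ˡ; ∈-++⁺ʳ; ∈-map⁺; ∈-map⁻; ∈-concat⁺′; ∈-concat⁻′)
open import Data.List.Relation.Binary.Subset.Propositional using (_⊆_)
open import Data.List.Relation.Unary.Any using (here; there)
import Data.List.Relation.Unary.Any.Properties as Any
import Data.List.Relation.Unary.All as All
open import Data.Product using (Σ; _×_; _,_; proj₁; proj₂)
open import Relation.Binary.PropositionalEquality using (_≡_; refl; sym; trans; subst)
open import Defs

-- Lemmas are opaque: only their statements are ever used, and unfolding the witnesses they
-- construct makes conversion checking blow up.
module _ {A : Set} where

  opaque
    finite-choice : {C : Set} {P : A → C → Set} (Z : List A) → (∀ z → z ∈ Z → Σ C (P z)) →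
      Σ (List C) λ Ys → (∀ y → y ∈ Ys → Σ A λ z → z ∈ Z × P z y)
                      × (∀ z → z ∈ Z → Σ C λ y → y ∈ Ys × P z y)
    finite-choice {C} {P} Z h = mapWith∈ Z (λ m → proj₁ (h _ m)) , chosen-from , chosen-for
      where
      chosen-from : ∀ y → y ∈ mapWith∈ Z (λ m → proj₁ (h _ m)) → Σ A λ z → z ∈ Z × P z y
      chosen-from y m with Any.mapWith∈⁻ Z _ m
      ... | z , mz , refl = z , mz , proj₂ (h z mz)
      chosen-for : ∀ z → z ∈ Z → Σ C λ y → y ∈ mapWith∈ Z (λ m → proj₁ (h _ m)) × P z y
      chosen-for z m = _ , Any.mapWith∈⁺ _ (z , m , refl) , proj₂ (h z m)

    finite-union-choice : {C : Set} {Q : A → List C → Set} (B : List A) → (∀ b → b ∈ B → Σ (List C) (Q b)) →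
      Σ (List C) λ L →
          (∀ x → x ∈ L → Σ A λ b → b ∈ B × Σ (List C) λ Lb → Q b Lb × x ∈ Lb)
        × (∀ b → b ∈ B → Σ (List C) λ Lb → Q b Lb × Lb ⊆ L)
    finite-union-choice B h =
      let (Ls , chosen-from , chosen-for) = finite-choice B h
      in concat Ls
       , (λ x m → let (Lb , x∈Lb , Lb∈Ls) = ∈-concat⁻′ Ls m
                      (b , mb , q) = chosen-from Lb Lb∈Ls
                  in b , mb , Lb , q , x∈Lb)
       , (λ b m → let (Lb , Lb∈Ls , q) = chosen-for b m in Lb , q , λ x∈Lb → ∈-concat⁺′ x∈Lb Lb∈Ls)

∈-singleton⁻ : {A : Set} {x y : A} → x ∈ [ y ] → x ≡ y
∈-singleton⁻ = Any.singleton⁻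

⋃ : {A : Set} → (List A → Set) → A → Set
⋃ 𝒰 x = Σ (List _) λ B → 𝒰 B × x ∈ B

⋃ᴸ : {A : Set} → List (List A) → A → Set
⋃ᴸ 𝓑 = ⋃ (_∈ 𝓑)

singletons : {A : Set} → List A → List (List A)
singletons = map [_]

⋃-singletons⁺ : {A : Set} {Z : List A} {x : A} → x ∈ Z → ⋃ᴸ (singletons Z) x
⋃-singletons⁺ {x = x} m = [ x ] , ∈-map⁺ [_] m , here refl

∈-singletons⁻ : {A : Set} {Z : List A} {B : List A} → B ∈ singletons Z → Σ A λ z → z ∈ Z × B ≡ [ z ]
∈-singletons⁻ = ∈-map⁻ [_]

singletons-∀ : {A : Set} {Z : List A} {P : List A → Set} →
  (∀ z → z ∈ Z → P [ z ]) → ∀ B → B ∈ singletons Z → P B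
singletons-∀ {P = P} Z-P B m with ∈-singletons⁻ m
... | z , z∈Z , refl = Z-P z z∈Z

_⊓⟨_⟩_ : {S : Set} → (S → Set) → (S → S → Set) → (S → Set) → S → Set
(U ⊓⟨ _≤_ ⟩ V) x = (Σ _ λ u → U u × x ≤ u) × (Σ _ λ v → V v × x ≤ v)

-- From strong continuous finitary covers to continuous basic covers

module StrongContinuousFinitaryCover (X : SCFC) where
  open SCFC X public

  _⋘_ : S → List S → Set
  a ⋘ A = ≪ X a A

  opaque
    ◀-trans : ∀ {a B C} → a ◀ B → (∀ b → b ∈ B → b ◀ C) → a ◀ C
    ◀-trans {B = B} {C} a◀B B◀C = cut-all B (◀-mono a◀B ∈-++⁺ˡ) B◀C
      where
      cut-all : ∀ {a} B → a ◀ (B ++ C) → (∀ b → b ∈ B → b ◀ C) → a ◀ C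
      cut-all []      a◀C   _   = a◀C
      cut-all (b ∷ B) a◀bBC B◀C =
        cut-all B (◀-cut a◀bBC (◀-mono (B◀C b (here refl)) (∈-++⁺ʳ B))) (λ b' m → B◀C b' (there m))

    ◀-refine : ∀ {a E} {P : S → Set} → a ◀ E →
      (∀ e → e ∈ E → Σ (List S) λ L → e ◀ L × (∀ h → h ∈ L → P h)) →
      Σ (List S) λ H → a ◀ H × (∀ h → h ∈ H → P h)
    ◀-refine {P = P} a◀E E-refine =
      let (H , H-from , H-for) = finite-union-choice {Q = λ e L → e ◀ L × (∀ h → h ∈ L → P h)} _ E-refine
      in H , ◀-trans a◀E (λ e m → let (L , (e◀L , _) , L⊆H) = H-for e m in ◀-mono e◀L L⊆H)
           , λ h m → let (_ , _ , L , (_ , L-P) , h∈L) = H-from h m in L-P h h∈L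

    ⋘⇒◀⊏ : ∀ {a A} → a ⋘ A → Σ (List S) λ B → a ◀ B × (∀ b → b ∈ B → Σ S λ c → c ∈ A × b ⊏ c)
    ⋘⇒◀⊏ {a} {A} = proj₁ (strong a A)

    ◀⊏⇒⋘ : ∀ {a A B} → a ◀ B → (∀ b → b ∈ B → Σ S λ c → c ∈ A × b ⊏ c) → a ⋘ A
    ◀⊏⇒⋘ {a} {A} {B} a◀B B⊏A = proj₂ (strong a A) (B , a◀B , B⊏A)

    ⊏⇒⋘ : ∀ {a b A} → a ⊏ b → b ∈ A → a ⋘ A
    ⊏⇒⋘ a⊏b b∈A = _ , a⊏b , ◀-refl b∈A

    ⊏-⋘-trans : ∀ {a b A} → a ⊏ b → b ⋘ A → a ⋘ A
    ⊏-⋘-trans a⊏b (c , b⊏c , c◀A) = c , ⊏-idem₂ a⊏b b⊏c , c◀A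

    ⋘-mono : ∀ {a A B} → a ⋘ A → A ⊆ B → a ⋘ B
    ⋘-mono (b , a⊏b , b◀A) A⊆B = b , a⊏b , ◀-mono b◀A A⊆B

    ⋘-interpolate : ∀ {a C} → a ⋘ C → Σ S λ a₁ → a ⊏ a₁ × a₁ ⋘ C
    ⋘-interpolate (b , a⊏b , b◀C) =
      let (a₁ , a⊏a₁ , a₁⊏b) = ⊏-idem₁ a⊏b in a₁ , a⊏a₁ , (b , a₁⊏b , b◀C)

    ⊏-◀-⋘-trans : ∀ {x y B C} → x ⊏ y → y ◀ B → (∀ e → e ∈ B → e ⋘ C) → x ⋘ C
    ⊏-◀-⋘-trans {x} {y} {B} {C} x⊏y y◀B B⋘C =
      let (D , y◀D , D⊏C) = ◀-refine {P = λ d → Σ S λ c → c ∈ C × d ⊏ c} y◀B (λ e m → ⋘⇒◀⊏ (B⋘C e m))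
          (E , x◀E , E⊏D) = ⋘⇒◀⊏ (y , x⊏y , y◀D)
      in ◀⊏⇒⋘ x◀E (λ f f∈E → let (d , d∈D , f⊏d) = E⊏D f f∈E
                                 (c , c∈C , d⊏c) = D⊏C d d∈D
                             in c , c∈C , ⊏-idem₂ f⊏d d⊏c)

    ⋘-trans : ∀ {a B C} → a ⋘ B → (∀ b → b ∈ B → b ⋘ C) → a ⋘ C
    ⋘-trans (a' , a⊏a' , a'◀B) = ⊏-◀-⋘-trans a⊏a' a'◀B


  _◁_ : S → (S → Set) → Set
  a ◁ U = ∀ b → b ⊏ a → Σ (List S) λ A → (∀ x → x ∈ A → U x) × b ⋘ A

  opaque
    ◁-refl : ∀ {a U} → U a → a ◁ U
    ◁-refl {a} Ua b b⊏a = [ a ] , (λ x m → subst _ (sym (∈-singleton⁻ m)) Ua) , ⊏⇒⋘ b⊏a (here refl)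

    ⋘-◁-choice : ∀ {a A V} → a ⋘ A → (∀ x → x ∈ A → x ◁ V) →
      Σ (List S) λ C → (∀ x → x ∈ C → V x) × a ⋘ C
    ⋘-◁-choice {a} {A} {V} a⋘A A◁V =
      let (a₁ , a⊏a₁ , a₁⋘A) = ⋘-interpolate a⋘A
          (B , a₁◀B , B⊏A) = ⋘⇒◀⊏ a₁⋘A
          (C , C-from , C-for) =
            finite-union-choice B (λ e m → let (u , u∈A , e⊏u) = B⊏A e m in A◁V u u∈A e e⊏u)
      in C , (λ x x∈C → let (_ , _ , Ce , (Ce⊆V , _) , x∈Ce) = C-from x x∈C in Ce⊆V x x∈Ce)
           , ⊏-◀-⋘-trans a⊏a₁ a₁◀B (λ e m → let (Ce , (_ , e⋘Ce) , Ce⊆C) = C-for e m in ⋘-mono e⋘Ce Ce⊆C)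

    ◁-trans : ∀ {a U V} → a ◁ U → (∀ u → U u → u ◁ V) → a ◁ V
    ◁-trans a◁U U◁V b b⊏a = let (A , A⊆U , b⋘A) = a◁U b b⊏a in ⋘-◁-choice b⋘A (λ x m → U◁V x (A⊆U x m))

    ◁-mono : ∀ {a U V} → a ◁ U → (∀ u → U u → V u) → a ◁ V
    ◁-mono a◁U U⊆V = ◁-trans a◁U (λ u Uu → ◁-refl (U⊆V u Uu))

    ⊏-◁-trans : ∀ {a a' U} → a ⊏ a' → a' ◁ U → a ◁ U
    ⊏-◁-trans a⊏a' a'◁U b b⊏a = a'◁U b (⊏-idem₂ b⊏a a⊏a')

    ⋘⇒◁ : ∀ {a A} → a ⋘ A → a ◁ (_∈ A)
    ⋘⇒◁ a⋘A b b⊏a = _ , (λ x m → m) , ⊏-⋘-trans b⊏a a⋘A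

    ◀⇒◁ : ∀ {a A} → a ◀ A → a ◁ (_∈ A)
    ◀⇒◁ a◀A b b⊏a = _ , (λ x m → m) , (_ , b⊏a , a◀A)

    ⊏⇒◁ : ∀ {a b} → a ⊏ b → a ◁ (_≡ b)
    ⊏⇒◁ a⊏b = ◁-mono (⋘⇒◁ (⊏⇒⋘ a⊏b (here refl))) (λ u m → ∈-singleton⁻ m)

    ⋘-◁-trans : ∀ {a A V} → a ⋘ A → (∀ x → x ∈ A → x ◁ V) → a ◁ V
    ⋘-◁-trans a⋘A A◁V = ◁-trans (⋘⇒◁ a⋘A) A◁V

    ◁-⊏ : ∀ a → a ◁ (_⊏ a)
    ◁-⊏ a b b⊏a =
      let (c , b⊏c , c⊏a) = ⊏-idem₁ b⊏a
      in [ c ] , (λ x m → subst (_⊏ a) (sym (∈-singleton⁻ m)) c⊏a) , ⊏⇒⋘ b⊏c (here refl)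

    ⊏-◁-finite : ∀ a b U → b ⊏ a → a ◁ U → Σ (List S) λ A → All.All U A × b ◁ (_∈ A)
    ⊏-◁-finite a b U b⊏a a◁U =
      let (A , A⊆U , b⋘A) = a◁U b b⊏a in A , All.tabulate (λ {x} m → A⊆U x m) , ⋘⇒◁ b⋘A

basicCover : SCFC → BCov
basicCover X = record { S = S ; _◁_ = _◁_ ; ◁-refl = ◁-refl ; ◁-trans = ◁-trans }
  where open StrongContinuousFinitaryCover X

contBasicCover : SCFC → CBC
contBasicCover X = record { bcov = basicCover X ; cont = _⊏_ , ◁-⊏ , ⊏-◁-finite }
  where open StrongContinuousFinitaryCover X

coverMap : (X Y : SCFC) → FRel X Y → BRel (basicCover X) (basicCover Y)
coverMap X Y r a b = StrongContinuousFinitaryCover._◁_ X a (λ c → r c [ b ])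

module JoinApproximable (X Y : SCFC) (r : FRel X Y) (ja : IsJoinApprox X Y r) where
  module X = StrongContinuousFinitaryCover X
  module Y = StrongContinuousFinitaryCover Y
  open X using (_◁_; ◁-refl; ◁-trans)

  opaque
    r-⋘-down : ∀ {a A C} → a X.⋘ A → (∀ a' → a' ∈ A → r a' C) → r a C
    r-⋘-down {a} {A} {C} a⋘A A-r = proj₁ (proj₁ ja a C) (A , a⋘A , A-r)

    r-⊏-down : ∀ {a a' C} → a X.⊏ a' → r a' C → r a C
    r-⊏-down {C = C} a⊏a' a'rC =
      r-⋘-down (X.⊏⇒⋘ a⊏a' (here refl)) (λ _ m → subst (λ z → r z C) (sym (∈-singleton⁻ m)) a'rC)

    r-⋘-up : ∀ {a B C} → r a B → (∀ b → b ∈ B → b Y.⋘ C) → r a C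
    r-⋘-up {a} {B} {C} arB B⋘C = proj₁ (proj₁ (proj₂ ja) a C) (B , arB , B⋘C)

    r-interpolate : ∀ {a B} → r a B → Σ (List Y.S) λ B' → r a B' × (∀ b → b ∈ B' → b Y.⋘ B)
    r-interpolate {a} {B} = proj₂ (proj₁ (proj₂ ja) a B)

    r-mono : ∀ {a B B'} → r a B → B ⊆ B' → r a B'
    r-mono arB B⊆B' = let (B'' , arB'' , B''⋘B) = r-interpolate arB in
      r-⋘-up arB'' (λ b m → Y.⋘-mono (B''⋘B b m) B⊆B')

    r-split : ∀ a B → r a B → Σ (List X.S) λ A → a X.◀ A × (∀ a' → a' ∈ A → Σ Y.S λ b → b ∈ B × r a' [ b ])
    r-split = proj₂ (proj₂ ja)

    r-split-⋘ : ∀ {a B} → r a B → Σ (List X.S) λ A → a X.⋘ A × (∀ a' → a' ∈ A → Σ Y.S λ b → b ∈ B × r a' [ b ])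
    r-split-⋘ {a} {B} arB =
      let (A₀ , (a' , a⊏a' , a'◀A₀) , A₀rB) = proj₂ (proj₁ ja a B) arB
          (A , a'◀A , A-r) = X.◀-refine a'◀A₀ (λ a₀ m → r-split a₀ B (A₀rB a₀ m))
      in A , (a' , a⊏a' , a'◀A) , A-r

    r-◁-refine : ∀ {w y V} → r w [ y ] → y Y.◁ V → Σ (List Y.S) λ C → r w C × (∀ z → z ∈ C → V z)
    r-◁-refine {w} {y} {V} wry y◁V =
      let (B , wrB , B⋘y) = r-interpolate wry
          (C , C-from , C-for) = finite-union-choice B
            (λ b m → Y.⋘-◁-choice (B⋘y b m) (λ x x∈y → subst (Y._◁ V) (sym (∈-singleton⁻ x∈y)) y◁V))
      in C , r-⋘-up wrB (λ b m → let (Cb , (_ , b⋘Cb) , Cb⊆C) = C-for b m in Y.⋘-mono b⋘Cb Cb⊆C)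
           , λ z z∈C → let (_ , _ , Cb , (Cb⊆V , _) , z∈Cb) = C-from z z∈C in Cb⊆V z z∈Cb

    r⇒◁pre : ∀ {c B V} → r c B → (∀ y → y ∈ B → V y) → c ◁ pre (coverMap X Y r) V
    r⇒◁pre crB B⊆V = let (A , c⋘A , A-r) = r-split-⋘ crB in
      X.⋘-◁-trans c⋘A (λ x m → let (b , b∈B , xrb) = A-r x m in ◁-refl (b , B⊆V b b∈B , ◁-refl xrb))

    coverMap-isBCMap : IsBCMap (basicCover X) (basicCover Y) (coverMap X Y r)
    coverMap-isBCMap =
        (λ a b a◁rb → ◁-trans a◁rb (λ _ q → q))
      , (λ b V b◁V a a◁rb → ◁-trans a◁rb λ c crb →
           let (C , crC , C⊆V) = r-◁-refine crb b◁V in r⇒◁pre crC C⊆V)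

coverMap-resp : (X Y : SCFC) (r r' : FRel X Y) → _≈F_ {X} {Y} r r' →
  _≈B_ {basicCover X} {basicCover Y} (coverMap X Y r) (coverMap X Y r')
coverMap-resp X Y r r' r≈r' a b =
    (λ p → ◁-mono p (λ u q → proj₁ (r≈r' u [ b ]) q))
  , (λ p → ◁-mono p (λ u q → proj₂ (r≈r' u [ b ]) q))
  where open StrongContinuousFinitaryCover X

coverMap-id : (X : SCFC) → _≈B_ {basicCover X} {basicCover X} (coverMap X X (≪ X)) (idB (basicCover X))
coverMap-id X a b =
    (λ p → ◁-trans p (λ c c⋘b → ◁-mono (⋘⇒◁ c⋘b) (λ u m → ∈-singleton⁻ m)))
  , (λ p → ◁-trans p (λ u u≡b → subst (_◁ (_⋘ [ b ])) (sym u≡b)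
                       (◁-mono (◁-⊏ b) (λ c c⊏b → ⊏⇒⋘ c⊏b (here refl)))))
  where open StrongContinuousFinitaryCover X

coverMap-∘ : (X Y Z : SCFC) (r : FRel X Y) (s : FRel Y Z) → IsJoinApprox X Y r →
  _≈B_ {basicCover X} {basicCover Z} (coverMap X Z (_·_ {X} {Y} {Z} s r))
    (_*_ {basicCover X} {basicCover Y} {basicCover Z} (coverMap Y Z s) (coverMap X Y r))
coverMap-∘ X Y Z r s jr a c = to , from
  where
  module X = StrongContinuousFinitaryCover X
  module Y = StrongContinuousFinitaryCover Y
  module R = JoinApproximable X Y r jr
  Fr = coverMap X Y r
  Fs = coverMap Y Z s

  to : coverMap X Z (_·_ {X} {Y} {Z} s r) a c → _*_ {basicCover X} {basicCover Y} {basicCover Z} Fs Fr a c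
  to a◁src = X.◁-trans a◁src through-r
    where
    through-r : ∀ x → _·_ {X} {Y} {Z} s r x [ c ] → x X.◁ pre Fr (λ y → Fs y c)
    through-r x (B , xrB , B-s) = R.r⇒◁pre xrB (λ y m → Y.◁-refl (B-s y m))

  from : _*_ {basicCover X} {basicCover Y} {basicCover Z} Fs Fr a c → coverMap X Z (_·_ {X} {Y} {Z} s r) a c
  from a◁FrFs = X.◁-trans a◁FrFs through-Fr
    where
    through-Fr : ∀ x → pre Fr (λ y → Fs y c) x → x X.◁ (λ w → _·_ {X} {Y} {Z} s r w [ c ])
    through-Fr x (y , y◁sc , x◁ry) = X.◁-trans x◁ry λ w wry → X.◁-refl (R.r-◁-refine wry y◁sc)

-- From continuous basic covers to strong continuous finitary covers

module ContinuousBasicCover (Y : CBC) where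
  open BCov (CBC.bcov Y) public

  wb : S → S → Set
  wb = proj₁ (CBC.cont Y)

  ◁-wb : ∀ a → a ◁ (λ x → wb x a)
  ◁-wb = proj₁ (proj₂ (CBC.cont Y))

  wb-◁-finite : ∀ {d c U} → wb d c → c ◁ U → Σ (List S) λ E → (∀ e → e ∈ E → U e) × d ◁ (_∈ E)
  wb-◁-finite {d} {c} {U} d≪c c◁U =
    let (E , E⊆U , d◁E) = proj₂ (proj₂ (CBC.cont Y)) c d U d≪c c◁U in E , (λ e m → All.lookup E⊆U m) , d◁E

  opaque
    ◁-mono : ∀ {a U V} → a ◁ U → (∀ u → U u → V u) → a ◁ V
    ◁-mono a◁U U⊆V = ◁-trans a◁U (λ u Uu → ◁-refl (U⊆V u Uu))

  _◁*_ : List S → (S → Set) → Set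
  A ◁* U = ∀ a → a ∈ A → a ◁ U

  opaque
    ◁*-trans : ∀ {A U V} → A ◁* U → (∀ u → U u → u ◁ V) → A ◁* V
    ◁*-trans A◁U U◁V a m = ◁-trans (A◁U a m) U◁V

    ◁*-refl : ∀ {A} → A ◁* (_∈ A)
    ◁*-refl a m = ◁-refl m

  _⋐_ : List S → (S → Set) → Set
  A ⋐ U = Σ (List S) λ D → A ◁* (_∈ D) × (∀ d → d ∈ D → Σ S λ c → wb d c × c ◁ U)

  opaque
    ⋐-◁-trans : ∀ {A U V} → A ⋐ U → (∀ u → U u → u ◁ V) → A ⋐ V
    ⋐-◁-trans (D , A◁D , D≪U) U◁V = D , A◁D , λ d m → let (c , d≪c , c◁U) = D≪U d m in c , d≪c , ◁-trans c◁U U◁V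

    ⋐-finite : ∀ {A U} → A ⋐ U → Σ (List S) λ E → (∀ e → e ∈ E → U e) × A ◁* (_∈ E)
    ⋐-finite (D , A◁D , D≪U) =
      let (E , E-from , E-for) =
            finite-union-choice D (λ d m → let (c , d≪c , c◁U) = D≪U d m in wb-◁-finite d≪c c◁U)
      in E , (λ e e∈E → let (_ , _ , Ed , (Ed⊆U , _) , e∈Ed) = E-from e e∈E in Ed⊆U e e∈Ed)
           , ◁*-trans A◁D (λ d m → let (Ed , (_ , d◁Ed) , Ed⊆E) = E-for d m in ◁-mono d◁Ed (λ _ → Ed⊆E))

    ⋐⇒◁* : ∀ {A U} → A ⋐ U → A ◁* U
    ⋐⇒◁* A⋐U = let (E , E⊆U , A◁E) = ⋐-finite A⋐U in ◁*-trans A◁E (λ u m → ◁-refl (E⊆U u m))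

  ⇊ : (S → Set) → S → Set
  ⇊ U z = Σ S λ y → U y × wb z y

  opaque
    ◁-⇊ : ∀ {a U} → a ◁ U → a ◁ ⇊ U
    ◁-⇊ a◁U = ◁-trans a◁U (λ u Uu → ◁-mono (◁-wb u) (λ z z≪u → u , Uu , z≪u))

    ⋐-⇊-finite : ∀ {A U} → A ⋐ U → Σ (List S) λ Z → A ◁* (_∈ Z) × (∀ z → z ∈ Z → ⇊ U z)
    ⋐-⇊-finite A⋐U =
      let (E , E⊆⇊U , A◁E) = ⋐-finite (⋐-◁-trans A⋐U (λ u Uu → ◁-⇊ (◁-refl Uu))) in E , A◁E , E⊆⇊U

    wb-◁⇒[]⋐ : ∀ {z y U} → wb z y → y ◁ U → [ z ] ⋐ U
    wb-◁⇒[]⋐ {z} {y} z≪y y◁U = [ z ] , ◁*-refl , λ d m → y , subst (λ t → wb t y) (sym (∈-singleton⁻ m)) z≪y , y◁U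

    ⋐-interpolate : ∀ {A U} → A ⋐ U → Σ (List S) λ B → A ⋐ (_∈ B) × B ⋐ U
    ⋐-interpolate {A} {U} A⋐U =
      let (Z , A◁Z , Z⊆⇊⇊U) = ⋐-⇊-finite (⋐-◁-trans A⋐U (λ u Uu → ◁-⇊ (◁-refl Uu)))
          (B , B-from , B-for) = finite-choice {P = λ z y → ⇊ U y × wb z y} Z
                                   (λ z m → let (y , y∈⇊U , z≪y) = Z⊆⇊⇊U z m in y , y∈⇊U , z≪y)
      in B , (Z , A◁Z , λ z m → let (y , y∈B , _ , z≪y) = B-for z m in y , z≪y , ◁-refl y∈B)
           , (B , ◁*-refl , λ y m → let (_ , _ , (u , Uu , y≪u) , _) = B-from y m in u , y≪u , ◁-refl Uu)

    ◁*-⋃-⋐-trans : ∀ {A 𝓑 U} → A ◁* ⋃ᴸ 𝓑 → (∀ B → B ∈ 𝓑 → B ⋐ U) → A ⋐ U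
    ◁*-⋃-⋐-trans {A} {𝓑} A◁𝓑 𝓑⋐U =
      let (D , D-from , D-for) = finite-union-choice 𝓑 𝓑⋐U
      in D , ◁*-trans A◁𝓑 (λ x (B , B∈𝓑 , x∈B) →
               let (DB , (B◁DB , _) , DB⊆D) = D-for B B∈𝓑 in ◁-mono (B◁DB x x∈B) (λ _ → DB⊆D))
           , λ d d∈D → let (_ , _ , DB , (_ , DB≪U) , d∈DB) = D-from d d∈D in DB≪U d d∈DB

finitaryCover : CBC → SCFC
finitaryCover Y = record
  { S = List S
  ; _◀_ = λ A 𝓐 → A ◁* ⋃ᴸ 𝓐
  ; _⊏_ = λ A B → A ⋐ (_∈ B)
  ; ◀-refl = λ A∈𝓐 a a∈A → ◁-refl (_ , A∈𝓐 , a∈A)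
  ; ◀-mono = λ A◁𝓐 𝓐⊆𝓑 → ◁*-trans A◁𝓐 (λ u (B , B∈𝓐 , u∈B) → ◁-refl (B , 𝓐⊆𝓑 B∈𝓐 , u∈B))
  ; ◀-cut = cut
  ; ⊏-idem₁ = ⋐-interpolate
  ; ⊏-idem₂ = λ A⋐B B⋐C → ⋐-◁-trans A⋐B (⋐⇒◁* B⋐C)
  ; strong = λ A 𝓐 → strong⇒ , strong⇐
  }
  where
  open ContinuousBasicCover Y
  cut : ∀ {A B 𝓐} → A ◁* ⋃ᴸ (B ∷ 𝓐) → B ◁* ⋃ᴸ 𝓐 → A ◁* ⋃ᴸ 𝓐
  cut A◁B𝓐 B◁𝓐 = ◁*-trans A◁B𝓐 λ
    { u (_ , here refl , u∈B) → B◁𝓐 u u∈B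
    ; u (B' , there B'∈𝓐 , u∈B') → ◁-refl (B' , B'∈𝓐 , u∈B') }
  strong⇒ : ∀ {A 𝓐} → Σ (List S) (λ B → A ⋐ (_∈ B) × B ◁* ⋃ᴸ 𝓐) →
    Σ (List (List S)) (λ 𝓑 → A ◁* ⋃ᴸ 𝓑 × (∀ B → B ∈ 𝓑 → Σ (List S) (λ C → C ∈ 𝓐 × B ⋐ (_∈ C))))
  strong⇒ (B , A⋐B , B◁𝓐) =
    let (Z , A◁Z , Z⊆⇊𝓐) = ⋐-⇊-finite (⋐-◁-trans A⋐B B◁𝓐)
    in singletons Z , ◁*-trans A◁Z (λ u m → ◁-refl (⋃-singletons⁺ m))
       , singletons-∀ λ z z∈Z → let (y , (C , C∈𝓐 , y∈C) , z≪y) = Z⊆⇊𝓐 z z∈Z in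
           C , C∈𝓐 , wb-◁⇒[]⋐ z≪y (◁-refl y∈C)
  strong⇐ : ∀ {A 𝓐} →
    Σ (List (List S)) (λ 𝓑 → A ◁* ⋃ᴸ 𝓑 × (∀ B → B ∈ 𝓑 → Σ (List S) (λ C → C ∈ 𝓐 × B ⋐ (_∈ C)))) →
    Σ (List S) (λ B → A ⋐ (_∈ B) × B ◁* ⋃ᴸ 𝓐)
  strong⇐ {A} {𝓐} (𝓑 , A◁𝓑 , 𝓑⋐𝓐) =
    let (B , B-from , B-for) = finite-union-choice {Q = λ B' C → C ∈ 𝓐 × B' ⋐ (_∈ C)} 𝓑 𝓑⋐𝓐
    in B , ◁*-⋃-⋐-trans A◁𝓑 (λ B' m →
             let (C , (_ , B'⋐C) , C⊆B) = B-for B' m in ⋐-◁-trans B'⋐C (λ u m → ◁-refl (C⊆B m)))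
         , λ x x∈B → let (_ , _ , C , (C∈𝓐 , _) , x∈C) = B-from x x∈B in ◁-refl (C , C∈𝓐 , x∈C)

finitaryMap : (X Y : CBC) → BRel (CBC.bcov X) (CBC.bcov Y) → FRel (finitaryCover X) (finitaryCover Y)
finitaryMap X Y r A 𝓑 = ContinuousBasicCover._⋐_ X A (pre r (⋃ᴸ 𝓑))

module BasicCoverMap (X Y : CBC) (r : BRel (CBC.bcov X) (CBC.bcov Y))
  (bc : IsBCMap (CBC.bcov X) (CBC.bcov Y) r) where
  module X = ContinuousBasicCover X
  module Y = ContinuousBasicCover Y
  open X
  private
    GX = finitaryCover X
    GY = finitaryCover Y
    Gr = finitaryMap X Y r

  opaque
    pre-◁-mono : ∀ {V W} → (∀ y → V y → y Y.◁ W) → ∀ u → pre r V u → u ◁ pre r W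
    pre-◁-mono {V} {W} V◁W u (y , Vy , ury) = proj₂ bc y W (V◁W y Vy) u ury

    ⋐-pre-finite : ∀ {A V} → A ⋐ pre r V → Σ (List Y.S) λ Z → (∀ z → z ∈ Z → V z) × A ⋐ pre r (_∈ Z)
    ⋐-pre-finite {A} {V} A⋐rV with ⋐-interpolate A⋐rV
    ... | B , A⋐B , B⋐rV with ⋐-finite B⋐rV
    ... | E , E⊆rV , B◁E with finite-choice {P = λ e y → V y × r e y} E E⊆rV
    ... | Z , Z-from , Z-for =
      Z , (λ z m → let (_ , _ , Vz , _) = Z-from z m in Vz)
        , ⋐-◁-trans A⋐B (◁*-trans B◁E (λ e m → let (y , y∈Z , _ , ery) = Z-for e m in ◁-refl (y , y∈Z , ery)))

    ⋐-pre-⇊-finite : ∀ {A V} → A ⋐ pre r V → Σ (List Y.S) λ Z → (∀ z → z ∈ Z → Y.⇊ V z) × A ⋐ pre r (_∈ Z)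
    ⋐-pre-⇊-finite A⋐rV = ⋐-pre-finite (⋐-◁-trans A⋐rV (pre-◁-mono (λ y Vy → Y.◁-⇊ (Y.◁-refl Vy))))

    ⋐-pre-singletons : ∀ {A Z} → A ⋐ pre r (_∈ Z) → Gr A (singletons Z)
    ⋐-pre-singletons A⋐rZ = ⋐-◁-trans A⋐rZ (λ u (y , y∈Z , ury) → ◁-refl (y , ⋃-singletons⁺ y∈Z , ury))

    r·≪⇒r : ∀ {A 𝓒} → _·_ {GX} {GX} {GY} Gr (≪ GX) A 𝓒 → Gr A 𝓒
    r·≪⇒r (𝓑 , (B , A⋐B , B◁𝓑) , 𝓑-r) =
      ⋐-◁-trans A⋐B (◁*-trans B◁𝓑 (λ u (B' , B'∈𝓑 , u∈B') → ⋐⇒◁* (𝓑-r B' B'∈𝓑) u u∈B'))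

    r⇒r·≪ : ∀ {A 𝓒} → Gr A 𝓒 → _·_ {GX} {GX} {GY} Gr (≪ GX) A 𝓒
    r⇒r·≪ A⋐r𝓒 =
      let (B , A⋐B , B⋐r𝓒) = ⋐-interpolate A⋐r𝓒
      in [ B ] , (B , A⋐B , λ u m → ◁-refl (B , here refl , m)) , λ { _ (here refl) → B⋐r𝓒 }

    ≪·r⇒r : ∀ {A 𝓒} → _·_ {GX} {GY} {GY} (≪ GY) Gr A 𝓒 → Gr A 𝓒
    ≪·r⇒r {𝓒 = 𝓒} (𝓑 , A⋐r𝓑 , 𝓑≪𝓒) = ⋐-◁-trans A⋐r𝓑 (pre-◁-mono 𝓑◁𝓒)
      where
      𝓑◁𝓒 : ∀ y → ⋃ᴸ 𝓑 y → y Y.◁ ⋃ᴸ 𝓒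
      𝓑◁𝓒 y (B , B∈𝓑 , y∈B) = let (B₀ , B⋐B₀ , B₀◁𝓒) = 𝓑≪𝓒 B B∈𝓑 in
        Y.⋐⇒◁* (Y.⋐-◁-trans B⋐B₀ B₀◁𝓒) y y∈B

    r⇒≪·r : ∀ {A 𝓒} → Gr A 𝓒 → _·_ {GX} {GY} {GY} (≪ GY) Gr A 𝓒
    r⇒≪·r {A} {𝓒} A⋐r𝓒 =
      let (Z , Z⊆⇊𝓒 , A⋐rZ) = ⋐-pre-⇊-finite A⋐r𝓒
      in singletons Z , ⋐-pre-singletons A⋐rZ
         , singletons-∀ λ z z∈Z → let (y , (C , C∈𝓒 , y∈C) , z≪y) = Z⊆⇊𝓒 z z∈Z in
             C , Y.wb-◁⇒[]⋐ z≪y (Y.◁-refl y∈C) , λ u u∈C → Y.◁-refl (C , C∈𝓒 , u∈C)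

    r-split : ∀ A 𝓑 → Gr A 𝓑 → Σ (List (List X.S)) λ 𝓐 → A ◁* ⋃ᴸ 𝓐 ×
      (∀ A' → A' ∈ 𝓐 → Σ (List Y.S) λ B → B ∈ 𝓑 × Gr A' [ B ])
    r-split A 𝓑 A⋐r𝓑 =
      let (Z , A◁Z , Z⊆⇊r𝓑) = ⋐-⇊-finite A⋐r𝓑
      in singletons Z , ◁*-trans A◁Z (λ u m → ◁-refl (⋃-singletons⁺ m))
         , singletons-∀ λ z z∈Z → let (x , (y , (B , B∈𝓑 , y∈B) , xry) , z≪x) = Z⊆⇊r𝓑 z z∈Z in
             B , B∈𝓑 , wb-◁⇒[]⋐ z≪x (◁-refl (y , (B , here refl , y∈B) , xry))

    finitaryMap-isJoinApprox : IsJoinApprox GX GY Gr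
    finitaryMap-isJoinApprox = (λ _ _ → r·≪⇒r , r⇒r·≪) , (λ _ _ → ≪·r⇒r , r⇒≪·r) , r-split

finitaryMap-resp : (X Y : CBC) (r r' : BRel (CBC.bcov X) (CBC.bcov Y)) → _≈B_ {CBC.bcov X} {CBC.bcov Y} r r' →
  _≈F_ {finitaryCover X} {finitaryCover Y} (finitaryMap X Y r) (finitaryMap X Y r')
finitaryMap-resp X Y r r' r≈r' A 𝓑 =
    (λ p → ⋐-◁-trans p (λ u (y , 𝓑y , ury) → ◁-refl (y , 𝓑y , proj₁ (r≈r' u y) ury)))
  , (λ p → ⋐-◁-trans p (λ u (y , 𝓑y , ur'y) → ◁-refl (y , 𝓑y , proj₂ (r≈r' u y) ur'y)))
  where open ContinuousBasicCover X

finitaryMap-id : (X : CBC) →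
  _≈F_ {finitaryCover X} {finitaryCover X} (finitaryMap X X (idB (CBC.bcov X))) (≪ (finitaryCover X))
finitaryMap-id X A 𝓑 = to , from
  where
  open ContinuousBasicCover X
  to : finitaryMap X X (idB (CBC.bcov X)) A 𝓑 → ≪ (finitaryCover X) A 𝓑
  to A⋐𝓑 =
    let (B , A⋐B , B⋐𝓑) = ⋐-interpolate (⋐-◁-trans A⋐𝓑 λ u (y , 𝓑y , u◁y) →
                             ◁-mono u◁y (λ x x≡y → subst (⋃ᴸ 𝓑) (sym x≡y) 𝓑y))
    in B , A⋐B , ⋐⇒◁* B⋐𝓑
  from : ≪ (finitaryCover X) A 𝓑 → finitaryMap X X (idB (CBC.bcov X)) A 𝓑
  from (B , A⋐B , B◁𝓑) = ⋐-◁-trans A⋐B (◁*-trans B◁𝓑 (λ u 𝓑u → ◁-refl (u , 𝓑u , ◁-refl refl)))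

finitaryMap-∘ : (X Y Z : CBC) (r : BRel (CBC.bcov X) (CBC.bcov Y)) (s : BRel (CBC.bcov Y) (CBC.bcov Z)) →
  IsBCMap (CBC.bcov X) (CBC.bcov Y) r →
  _≈F_ {finitaryCover X} {finitaryCover Z} (finitaryMap X Z (_*_ {CBC.bcov X} {CBC.bcov Y} {CBC.bcov Z} s r))
    (_·_ {finitaryCover X} {finitaryCover Y} {finitaryCover Z} (finitaryMap Y Z s) (finitaryMap X Y r))
finitaryMap-∘ X Y Z r s br A 𝓒 = to , from
  where
  open ContinuousBasicCover X
  module Y = ContinuousBasicCover Y
  module R = BasicCoverMap X Y r br
  U = ⋃ᴸ 𝓒
  to : finitaryMap X Z (_*_ {CBC.bcov X} {CBC.bcov Y} {CBC.bcov Z} s r) A 𝓒 →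
       _·_ {finitaryCover X} {finitaryCover Y} {finitaryCover Z} (finitaryMap Y Z s) (finitaryMap X Y r) A 𝓒
  to A⋐sr𝓒 =
    let (W , W⊆⇊s𝓒 , A⋐rW) = R.⋐-pre-⇊-finite {V = pre s U} (⋐-◁-trans A⋐sr𝓒 λ u (z , Uz , u◁rsz) →
                                 ◁-mono u◁rsz (λ x (y , ysz , xry) → y , (z , Uz , ysz) , xry))
    in singletons W , R.⋐-pre-singletons A⋐rW
       , singletons-∀ λ w w∈W → let (y , s𝓒y , w≪y) = W⊆⇊s𝓒 w w∈W in Y.wb-◁⇒[]⋐ w≪y (Y.◁-refl s𝓒y)
  from : _·_ {finitaryCover X} {finitaryCover Y} {finitaryCover Z} (finitaryMap Y Z s) (finitaryMap X Y r) A 𝓒 →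
         finitaryMap X Z (_*_ {CBC.bcov X} {CBC.bcov Y} {CBC.bcov Z} s r) A 𝓒
  from (𝓑 , A⋐r𝓑 , 𝓑-s) = ⋐-◁-trans A⋐r𝓑 (λ u ur𝓑 → ◁-trans (R.pre-◁-mono 𝓑◁s𝓒 u ur𝓑)
      (λ x (y , (z , Uz , ysz) , xry) → ◁-refl (z , Uz , ◁-refl (y , ysz , xry))))
    where
    𝓑◁s𝓒 : ∀ y → ⋃ᴸ 𝓑 y → y Y.◁ pre s U
    𝓑◁s𝓒 y (B , B∈𝓑 , y∈B) = Y.⋐⇒◁* (𝓑-s B B∈𝓑) y y∈B

-- Unit and counit

η-to : (X : SCFC) → FRel X (finitaryCover (contBasicCover X))
η-to X a 𝓑 = Σ S λ a' → a ⊏ a' × a' ◁ ⋃ᴸ 𝓑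
  where open StrongContinuousFinitaryCover X

η-from : (X : SCFC) → FRel (finitaryCover (contBasicCover X)) X
η-from X A C = A ⋐ (_∈ C)
  where open ContinuousBasicCover (contBasicCover X)

module Unit (X : SCFC) where
  open StrongContinuousFinitaryCover X
  module F = ContinuousBasicCover (contBasicCover X)
  open F using (_⋐_; _◁*_; ⋐-◁-trans; ⋐⇒◁*; ⋐-interpolate; wb-◁⇒[]⋐; ◁*-trans)
  private
    GF = finitaryCover (contBasicCover X)
    α = η-to X
    β = η-from X

  opaque
    ⊏-◁-⇊-finite : ∀ {a a₂ V} → a ⊏ a₂ → a₂ ◁ V →
      Σ S λ a₁ → Σ (List S) λ Z → a ⊏ a₁ × a₁ ◁ (_∈ Z) × (∀ z → z ∈ Z → F.⇊ V z)
    ⊏-◁-⇊-finite a⊏a₂ a₂◁V =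
      let (a₁ , a⊏a₁ , a₁⊏a₂) = ⊏-idem₁ a⊏a₂
          (Z , Z⊆⇊V , a₁⋘Z) = F.◁-⇊ a₂◁V a₁ a₁⊏a₂
      in a₁ , Z , a⊏a₁ , ⋘⇒◁ a₁⋘Z , Z⊆⇊V

    α·≪⇒α : ∀ {a 𝓑} → _·_ {X} {X} {GF} α (≪ X) a 𝓑 → α a 𝓑
    α·≪⇒α (B , a⋘B , B-α) =
      let (a₁ , a⊏a₁ , a₁⋘B) = ⋘-interpolate a⋘B
      in a₁ , a⊏a₁ , ⋘-◁-trans a₁⋘B (λ x m → let (x' , x⊏x' , x'◁𝓑) = B-α x m in ⊏-◁-trans x⊏x' x'◁𝓑)

    α⇒α·≪ : ∀ {a 𝓑} → α a 𝓑 → _·_ {X} {X} {GF} α (≪ X) a 𝓑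
    α⇒α·≪ (a' , a⊏a' , a'◁𝓑) =
      let (a₁ , a⊏a₁ , a₁⊏a') = ⊏-idem₁ a⊏a'
      in [ a₁ ] , ⊏⇒⋘ a⊏a₁ (here refl) , λ { _ (here refl) → a' , a₁⊏a' , a'◁𝓑 }

    ≪·α⇒α : ∀ {a 𝓒} → _·_ {X} {GF} {GF} (≪ GF) α a 𝓒 → α a 𝓒
    ≪·α⇒α {𝓒 = 𝓒} (𝓑 , (a' , a⊏a' , a'◁𝓑) , 𝓑≪𝓒) = a' , a⊏a' , ◁-trans a'◁𝓑 𝓑◁𝓒
      where
      𝓑◁𝓒 : ∀ u → ⋃ᴸ 𝓑 u → u ◁ ⋃ᴸ 𝓒
      𝓑◁𝓒 u (B , B∈𝓑 , u∈B) = let (B₀ , B⋐B₀ , B₀◁𝓒) = 𝓑≪𝓒 B B∈𝓑 in ⋐⇒◁* (⋐-◁-trans B⋐B₀ B₀◁𝓒) u u∈B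

    α⇒≪·α : ∀ {a 𝓒} → α a 𝓒 → _·_ {X} {GF} {GF} (≪ GF) α a 𝓒
    α⇒≪·α (a' , a⊏a' , a'◁𝓒) =
      let (a₁ , Z , a⊏a₁ , a₁◁Z , Z⊆⇊𝓒) = ⊏-◁-⇊-finite a⊏a' a'◁𝓒
      in singletons Z , (a₁ , a⊏a₁ , ◁-mono a₁◁Z (λ u → ⋃-singletons⁺))
         , singletons-∀ λ z z∈Z → let (y , (C , C∈𝓒 , y∈C) , z⊏y) = Z⊆⇊𝓒 z z∈Z in
             C , wb-◁⇒[]⋐ z⊏y (◁-refl y∈C) , λ u u∈C → ◁-refl (C , C∈𝓒 , u∈C)

    α-split : ∀ a 𝓑 → α a 𝓑 → Σ (List S) λ A → a ◀ A × (∀ a' → a' ∈ A → Σ (List S) λ B → B ∈ 𝓑 × α a' [ B ])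
    α-split a 𝓑 (a' , a⊏a' , a'◁𝓑) =
      let (A₀ , A₀⊆𝓑 , a⋘A₀) = a'◁𝓑 a a⊏a'
          (A , a◀A , A⊏A₀) = ⋘⇒◀⊏ a⋘A₀
      in A , a◀A , λ e e∈A → let (u , u∈A₀ , e⊏u) = A⊏A₀ e e∈A
                                 (B , B∈𝓑 , u∈B) = A₀⊆𝓑 u u∈A₀
                             in B , B∈𝓑 , (u , e⊏u , ◁-refl (B , here refl , u∈B))

    η-to-isJoinApprox : IsJoinApprox X GF α
    η-to-isJoinApprox = (λ _ _ → α·≪⇒α , α⇒α·≪) , (λ _ _ → ≪·α⇒α , α⇒≪·α) , α-split

    β·≪⇒β : ∀ {A C} → _·_ {GF} {GF} {X} β (≪ GF) A C → β A C
    β·≪⇒β (𝓑 , (B₀ , A⋐B₀ , B₀◁𝓑) , 𝓑-β) =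
      ⋐-◁-trans A⋐B₀ (◁*-trans B₀◁𝓑 (λ u (B , B∈𝓑 , u∈B) → ⋐⇒◁* (𝓑-β B B∈𝓑) u u∈B))

    β⇒β·≪ : ∀ {A C} → β A C → _·_ {GF} {GF} {X} β (≪ GF) A C
    β⇒β·≪ A⋐C =
      let (B , A⋐B , B⋐C) = ⋐-interpolate A⋐C
      in [ B ] , (B , A⋐B , λ u m → ◁-refl (B , here refl , m)) , λ { _ (here refl) → B⋐C }

    ≪·β⇒β : ∀ {A C} → _·_ {GF} {X} {X} (≪ X) β A C → β A C
    ≪·β⇒β (B , A⋐B , B⋘C) = ⋐-◁-trans A⋐B (λ b m → ⋘⇒◁ (B⋘C b m))

    β⇒≪·β : ∀ {A C} → β A C → _·_ {GF} {X} {X} (≪ X) β A C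
    β⇒≪·β A⋐C =
      let (B , A⋐B , (D , B◁D , D⊏C)) = ⋐-interpolate A⋐C
      in D , ⋐-◁-trans A⋐B B◁D
           , λ d m → let (c , d⊏c , c◁C) = D⊏C d m
                         (A' , A'⊆C , d⋘A') = c◁C d d⊏c
                     in ⋘-mono d⋘A' (A'⊆C _)

    β-split : ∀ A C → β A C → Σ (List (List S)) λ 𝓐 → A ◁* ⋃ᴸ 𝓐 × (∀ A' → A' ∈ 𝓐 → Σ S λ c → c ∈ C × β A' [ c ])
    β-split A C A⋐C =
      let (Z , A◁Z , Z⊆⇊C) = F.⋐-⇊-finite A⋐C
      in singletons Z , ◁*-trans A◁Z (λ u m → ◁-refl (⋃-singletons⁺ m))
         , singletons-∀ λ z z∈Z → let (y , y∈C , z⊏y) = Z⊆⇊C z z∈Z in y , y∈C , wb-◁⇒[]⋐ z⊏y (◁-refl (here refl))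

    η-from-isJoinApprox : IsJoinApprox GF X β
    η-from-isJoinApprox = (λ _ _ → β·≪⇒β , β⇒β·≪) , (λ _ _ → ≪·β⇒β , β⇒≪·β) , β-split

    β·α⇒≪ : ∀ {a C} → _·_ {X} {GF} {X} β α a C → a ⋘ C
    β·α⇒≪ {a} (𝓑 , (a' , a⊏a' , a'◁𝓑) , 𝓑-β) =
      let (A' , A'⊆C , a⋘A') = ◁-trans a'◁𝓑 (λ u (B , B∈𝓑 , u∈B) → ⋐⇒◁* (𝓑-β B B∈𝓑) u u∈B) a a⊏a'
      in ⋘-mono a⋘A' (A'⊆C _)

    ≪⇒β·α : ∀ {a C} → a ⋘ C → _·_ {X} {GF} {X} β α a C
    ≪⇒β·α (a₂ , a⊏a₂ , a₂◀C) =
      let (a₁ , a⊏a₁ , a₁⊏a₂) = ⊏-idem₁ a⊏a₂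
          (a₁' , a₁⊏a₁' , a₁'⊏a₂) = ⊏-idem₁ a₁⊏a₂
      in [ [ a₁' ] ] , (a₁ , a⊏a₁ , ◁-mono (⊏⇒◁ a₁⊏a₁') (λ u u≡a₁' → [ a₁' ] , here refl , here u≡a₁'))
         , λ { _ (here refl) → wb-◁⇒[]⋐ a₁'⊏a₂ (◀⇒◁ a₂◀C) }

    α·β⇒≪ : ∀ {A 𝓒} → _·_ {GF} {X} {GF} α β A 𝓒 → ≪ GF A 𝓒
    α·β⇒≪ (C , A⋐C , C-α) = C , A⋐C , λ c m → let (c' , c⊏c' , c'◁𝓒) = C-α c m in ⊏-◁-trans c⊏c' c'◁𝓒

    ≪⇒α·β : ∀ {A 𝓒} → ≪ GF A 𝓒 → _·_ {GF} {X} {GF} α β A 𝓒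
    ≪⇒α·β (B , A⋐B , B◁𝓒) =
      let (C , A⋐C , (D , C◁D , D⊏𝓒)) = ⋐-interpolate (⋐-◁-trans A⋐B B◁𝓒)
      in D , ⋐-◁-trans A⋐C C◁D , D⊏𝓒

module UnitNatural (X Y : SCFC) (r : FRel X Y) (ja : IsJoinApprox X Y r) where
  open StrongContinuousFinitaryCover X
  module Y = StrongContinuousFinitaryCover Y
  module F = ContinuousBasicCover (contBasicCover X)
  module R = JoinApproximable X Y r ja
  private
    GFX = finitaryCover (contBasicCover X)
    GFY = finitaryCover (contBasicCover Y)
    Fr = coverMap X Y r
    GFr = finitaryMap (contBasicCover X) (contBasicCover Y) Fr
    α·r = _·_ {X} {Y} {GFY} (η-to Y) r
    GFr·α = _·_ {X} {GFX} {GFY} GFr (η-to X)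

  opaque
    r-⋃⇒GFr·α : ∀ {a 𝓒} C → (∀ y → y ∈ C → ⋃ᴸ 𝓒 y) → r a C → GFr·α a 𝓒
    r-⋃⇒GFr·α {a} {𝓒} C C⊆𝓒 arC =
      let (A , (a₂ , a⊏a₂ , a₂◀A) , A-r) = R.r-split-⋘ arC
          a₂◁Fr𝓒 : a₂ ◁ pre Fr (⋃ᴸ 𝓒)
          a₂◁Fr𝓒 = ◁-mono (◀⇒◁ a₂◀A) (λ x m → let (y , y∈C , xry) = A-r x m in y , C⊆𝓒 y y∈C , ◁-refl xry)
          (a₁ , Z , a⊏a₁ , a₁◁Z , Z⊆⇊Fr𝓒) = Unit.⊏-◁-⇊-finite X a⊏a₂ a₂◁Fr𝓒
      in singletons Z , (a₁ , a⊏a₁ , ◁-mono a₁◁Z (λ u → ⋃-singletons⁺))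
         , singletons-∀ λ z z∈Z → let (y , Fr𝓒y , z⊏y) = Z⊆⇊Fr𝓒 z z∈Z in F.wb-◁⇒[]⋐ z⊏y (◁-refl Fr𝓒y)

    α·r⇒GFr·α : ∀ {a 𝓒} → α·r a 𝓒 → GFr·α a 𝓒
    α·r⇒GFr·α {a} {𝓒} (B , arB , B-α) =
      let (C , C-from , C-for) = finite-union-choice {Q = λ b L → (∀ x → x ∈ L → ⋃ᴸ 𝓒 x) × b Y.⋘ L} B
                                   (λ b m → let (b' , b⊏b' , b'◁𝓒) = B-α b m in b'◁𝓒 b b⊏b')
      in r-⋃⇒GFr·α C (λ y y∈C → let (_ , _ , L , (L⊆𝓒 , _) , y∈L) = C-from y y∈C in L⊆𝓒 y y∈L)
           (R.r-⋘-up arB (λ b m → let (L , (_ , b⋘L) , L⊆C) = C-for b m in Y.⋘-mono b⋘L L⊆C))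

    r-⋃⇒α·r : ∀ {a 𝓒} C → (∀ y → y ∈ C → ⋃ᴸ 𝓒 y) → r a C → α·r a 𝓒
    r-⋃⇒α·r C C⊆𝓒 arC =
      let (B , arB , B⋘C) = R.r-interpolate arC
      in B , arB , λ b m → let (b' , b⊏b' , b'◀C) = B⋘C b m in b' , b⊏b' , Y.◁-mono (Y.◀⇒◁ b'◀C) C⊆𝓒

    GFr·α⇒α·r : ∀ {a 𝓒} → GFr·α a 𝓒 → α·r a 𝓒
    GFr·α⇒α·r {a} {𝓒} (𝓑 , (a' , a⊏a' , a'◁𝓑) , 𝓑-GFr) =
      let a'◁r𝓒 = ◁-trans a'◁𝓑 (λ u (B , B∈𝓑 , u∈B) → F.⋐⇒◁* (𝓑-GFr B B∈𝓑) u u∈B)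
          a'◁r𝓒' = ◁-trans a'◁r𝓒 (λ x (y , 𝓒y , x◁ry) → ◁-mono x◁ry (λ c cry → y , 𝓒y , cry))
          (A , A⊆r𝓒 , a⋘A) = a'◁r𝓒' a a⊏a'
          (C , C-from , C-for) = finite-choice {P = λ c y → ⋃ᴸ 𝓒 y × r c [ y ]} A A⊆r𝓒
          arC = R.r-⋘-down a⋘A (λ c m → let (y , y∈C , _ , cry) = C-for c m in
                  R.r-mono cry (λ x∈y → subst (_∈ C) (sym (∈-singleton⁻ x∈y)) y∈C))
      in r-⋃⇒α·r C (λ u u∈C → let (_ , _ , 𝓒u , _) = C-from u u∈C in 𝓒u) arC

    η-to-natural : _≈F_ {X} {GFY} α·r GFr·α
    η-to-natural a 𝓒 = α·r⇒GFr·α , GFr·α⇒α·r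

ε-to : (Y : CBC) → BRel (basicCover (finitaryCover Y)) (CBC.bcov Y)
ε-to Y A y = A ◁* (_≡ y)
  where open ContinuousBasicCover Y

ε-from : (Y : CBC) → BRel (CBC.bcov Y) (basicCover (finitaryCover Y))
ε-from Y y B = y ◁ (_∈ B)
  where open ContinuousBasicCover Y

module Counit (Y : CBC) where
  open ContinuousBasicCover Y
  module G = StrongContinuousFinitaryCover (finitaryCover Y)
  private
    FG = basicCover (finitaryCover Y)
    Y' = CBC.bcov Y
    α = ε-to Y
    β = ε-from Y

  opaque
    singleton-ε-to : ∀ x → α [ x ] x
    singleton-ε-to x _ m = ◁-refl (∈-singleton⁻ m)

    ◁-⋃-pre-ε-to : ∀ {P w} → P w → w ◁ ⋃ (pre α P)
    ◁-⋃-pre-ε-to {w = w} Pw = ◁-refl ([ w ] , (w , Pw , singleton-ε-to w) , here refl)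

    ◁*-⋃⇒G◁ : ∀ {A 𝒰} → A ◁* ⋃ 𝒰 → A G.◁ 𝒰
    ◁*-⋃⇒G◁ {A} {𝒰} A◁𝒰 B B⋐A =
      let (B₁ , B⋐B₁ , B₁⋐𝒰) = ⋐-interpolate (⋐-◁-trans B⋐A A◁𝒰)
          (E , E⊆𝒰 , B₁◁E) = ⋐-finite B₁⋐𝒰
          (𝓑 , 𝓑-from , 𝓑-for) = finite-choice {P = λ e C → 𝒰 C × e ∈ C} E E⊆𝒰
      in 𝓑 , (λ C m → let (_ , _ , 𝒰C , _) = 𝓑-from C m in 𝒰C)
           , (B₁ , B⋐B₁ , ◁*-trans B₁◁E λ e m → let (C , C∈𝓑 , _ , e∈C) = 𝓑-for e m in ◁-refl (C , C∈𝓑 , e∈C))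

    G◁⇒◁*-⋃ : ∀ {A 𝒰} → A G.◁ 𝒰 → A ◁* ⋃ 𝒰
    G◁⇒◁*-⋃ {A} {𝒰} A◁𝒰 a a∈A = ◁-trans (◁-wb a) below-a
      where
      below-a : ∀ z → wb z a → z ◁ ⋃ 𝒰
      below-a z z≪a =
        let (𝓑 , 𝓑⊆𝒰 , (B₀ , z⋐B₀ , B₀◁𝓑)) = A◁𝒰 [ z ] (wb-◁⇒[]⋐ z≪a (◁-refl a∈A))
        in ◁-mono (⋐⇒◁* (⋐-◁-trans z⋐B₀ B₀◁𝓑) z (here refl)) (λ x (B , B∈𝓑 , x∈B) → B , 𝓑⊆𝒰 B B∈𝓑 , x∈B)

    ε-to-isBCMap : IsBCMap FG Y' α
    ε-to-isBCMap =
        (λ A y A◁αy → ◁*-trans (G◁⇒◁*-⋃ A◁αy) (λ x (B , B◁y , x∈B) → B◁y x x∈B))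
      , (λ y V y◁V A A◁y → ◁*-⋃⇒G◁ (◁*-trans (◁*-trans A◁y (λ u u≡y → subst (_◁ V) (sym u≡y) y◁V))
          (λ v Vv → ◁-⋃-pre-ε-to Vv)))

    ε-from-isBCMap : IsBCMap Y' FG β
    ε-from-isBCMap =
        (λ y B y◁βB → ◁-trans y◁βB (λ u q → q))
      , (λ B 𝒱 B◁𝒱 y y◁B → ◁-trans y◁B (λ u u∈B →
          ◁-mono (G◁⇒◁*-⋃ B◁𝒱 u u∈B) (λ x (B' , 𝒱B' , x∈B') → B' , 𝒱B' , ◁-refl x∈B')))

    β*α⇒id : ∀ {A B} → _*_ {FG} {Y'} {FG} β α A B → idB FG A B
    β*α⇒id {A} {B} A◁βα = ◁*-⋃⇒G◁ (◁*-trans (G◁⇒◁*-⋃ A◁βα) λ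
      { x (A' , (y , y◁B , A'◁y) , x∈A') →
          ◁-trans (◁-trans (A'◁y x x∈A') (λ u u≡y → subst (_◁ (_∈ B)) (sym u≡y) y◁B))
            (λ b b∈B → ◁-refl (B , refl , b∈B)) })

    id⇒β*α : ∀ {A B} → idB FG A B → _*_ {FG} {Y'} {FG} β α A B
    id⇒β*α {A} {B} A◁B = ◁*-⋃⇒G◁ (◁*-trans (G◁⇒◁*-⋃ A◁B) λ
      { x (_ , refl , x∈B) → ◁-⋃-pre-ε-to (◁-refl x∈B) })

    α*β⇒id : ∀ {y y'} → _*_ {Y'} {FG} {Y'} α β y y' → idB Y' y y'
    α*β⇒id y◁αβ = ◁-trans y◁αβ (λ x (B , B◁y' , x∈B) → ◁-trans x∈B B◁y')

    id⇒α*β : ∀ {y y'} → idB Y' y y' → _*_ {Y'} {FG} {Y'} α β y y'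
    id⇒α*β y◁y' = ◁-trans y◁y' λ u u≡y' →
      ◁-refl ([ u ] , (λ x m → ◁-refl (trans (∈-singleton⁻ m) u≡y')) , ◁-refl (here refl))

module CounitNatural (X Y : CBC) (r : BRel (CBC.bcov X) (CBC.bcov Y)) (bc : IsBCMap (CBC.bcov X) (CBC.bcov Y) r) where
  open ContinuousBasicCover X
  module Y = ContinuousBasicCover Y
  module CX = Counit X
  module R = BasicCoverMap X Y r bc
  private
    FGX = basicCover (finitaryCover X)
    FGY = basicCover (finitaryCover Y)
    FGr = coverMap (finitaryCover X) (finitaryCover Y) (finitaryMap X Y r)
    α*FGr = _*_ {FGX} {FGY} {CBC.bcov Y} (ε-to Y) FGr
    r*α = _*_ {FGX} {CBC.bcov X} {CBC.bcov Y} r (ε-to X)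

  opaque
    α*FGr⇒r*α : ∀ {A y} → α*FGr A y → r*α A y
    α*FGr⇒r*α {A} {y} A◁αFGr = CX.◁*-⋃⇒G◁ (◁*-trans (CX.G◁⇒◁*-⋃ A◁αFGr) λ
      { x (A' , (B , B◁y , A'FGrB) , x∈A') →
          ◁-trans (◁-trans (CX.G◁⇒◁*-⋃ A'FGrB x x∈A')
                    (λ x' (C , C⋐rB , x'∈C) → ◁-trans (⋐⇒◁* C⋐rB x' x'∈C) (R.pre-◁-mono (B◁y-⋃ B B◁y))))
            λ { x' (_ , refl , x'ry) → CX.◁-⋃-pre-ε-to x'ry } })
      where
      B◁y-⋃ : ∀ B → ε-to Y B y → ∀ y' → ⋃ᴸ [ B ] y' → y' Y.◁ (_≡ y)
      B◁y-⋃ B B◁y y' (_ , here refl , y'∈B) = B◁y y' y'∈B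

    r*α⇒α*FGr : ∀ {A y} → r*α A y → α*FGr A y
    r*α⇒α*FGr {A} {y} A◁rα = CX.◁*-⋃⇒G◁ (◁*-trans (CX.G◁⇒◁*-⋃ A◁rα) λ
      { x (A' , (x₀ , x₀ry , A'◁x₀) , x∈A') →
          ◁-trans (A'◁x₀ x x∈A') (λ u u≡x₀ → subst (_◁ _) (sym u≡x₀) (◁-trans (◁-wb x₀) (below x₀ x₀ry))) })
      where
      below : ∀ x₀ → r x₀ y → ∀ z → wb z x₀ → z ◁ ⋃ (pre FGr (λ B → ε-to Y B y))
      below x₀ x₀ry z z≪x₀ = ◁-refl ([ z ] , ([ y ] , Counit.singleton-ε-to Y y ,
        CX.◁*-⋃⇒G◁ (λ x m → ◁-refl ([ z ] , wb-◁⇒[]⋐ z≪x₀ (◁-refl (y , ([ y ] , here refl , here refl) , x₀ry)) , m)))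
        , here refl)

    ε-to-natural : _≈B_ {FGX} {CBC.bcov Y} α*FGr r*α
    ε-to-natural A y = α*FGr⇒r*α , r*α⇒α*FGr

coverFunctor : Functor SContFCov ContBCov
coverFunctor = record
  { F₀ = contBasicCover
  ; F₁ = λ {X} {Y} r _ → coverMap X Y r
  ; F-hom = λ {X} {Y} r p → JoinApproximable.coverMap-isBCMap X Y r (lower p)
  ; F-resp = λ {X} {Y} {r} {r'} _ _ → coverMap-resp X Y r r'
  ; F-id = λ X _ → coverMap-id X
  ; F-∘ = λ {X} {Y} {Z} r s p _ _ → coverMap-∘ X Y Z r s (lower p)
  }

finitaryFunctor : Functor ContBCov SContFCov
finitaryFunctor = record
  { F₀ = finitaryCover
  ; F₁ = λ {X} {Y} r _ → finitaryMap X Y r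
  ; F-hom = λ {X} {Y} r p → lift (BasicCoverMap.finitaryMap-isJoinApprox X Y r p)
  ; F-resp = λ {X} {Y} {r} {r'} _ _ → finitaryMap-resp X Y r r'
  ; F-id = λ X _ → finitaryMap-id X
  ; F-∘ = λ {X} {Y} {Z} r s p _ _ → finitaryMap-∘ X Y Z r s p
  }

SContFCov≃ContBCov : Equivalence SContFCov ContBCov
SContFCov≃ContBCov = record
  { F = coverFunctor
  ; G = finitaryFunctor
  ; η = record
    { α = η-to
    ; α-hom = λ X → lift (Unit.η-to-isJoinApprox X)
    ; β = η-from
    ; β-hom = λ X → lift (Unit.η-from-isJoinApprox X)
    ; βα = λ X _ _ → Unit.β·α⇒≪ X , Unit.≪⇒β·α X
    ; αβ = λ X _ _ → Unit.α·β⇒≪ X , Unit.≪⇒α·β X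
    ; nat = λ {X} {Y} r p → UnitNatural.η-to-natural X Y r (lower p)
    }
  ; ε = record
    { α = ε-to
    ; α-hom = Counit.ε-to-isBCMap
    ; β = ε-from
    ; β-hom = Counit.ε-from-isBCMap
    ; βα = λ Y _ _ → Counit.β*α⇒id Y , Counit.id⇒β*α Y
    ; αβ = λ Y _ _ → Counit.α*β⇒id Y , Counit.id⇒α*β Y
    ; nat = λ {X} {Y} r p → CounitNatural.ε-to-natural X Y r p
    }
  }

-- Localized covers and locally compact formal topologies

module LocalizedCover (X : SCFC) (loc : Localized X) where
  open StrongContinuousFinitaryCover X

  _⊏∈_ : S → List S → Set
  h ⊏∈ A = Σ S λ a → a ∈ A × h ⊏ a

  _≤_ : S → S → Set
  a ≤ b = a ◁ (_≡ b)

  _⊓_ : (S → Set) → (S → Set) → S → Set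
  U ⊓ V = U ⊓⟨ _≤_ ⟩ V

  opaque
    ⋘-meet : ∀ {y w A₁ A₂} → y ⊏ w → w ⋘ A₁ → w ⋘ A₂ →
      Σ (List S) λ H → y ◀ H × (∀ h → h ∈ H → h ⊏∈ A₁ × h ⊏∈ A₂)
    ⋘-meet {y} {w} {A₁} {A₂} y⊏w w⋘A₁ w⋘A₂ with ⊏-idem₁ y⊏w | ⋘⇒◀⊏ w⋘A₁
    ... | y₁ , y⊏y₁ , y₁⊏w | C , w◀C , C⊏A₁ with loc y₁⊏w w◀C
    ... | E , E-below , y₁◀E with loc y⊏y₁ y₁◀E
    ... | E' , E'-below , y◀E' = ◀-refine y◀E' (λ e' m → refine (All.lookup E'-below m))
      where
      refine : ∀ {e'} → e' ⊏ y₁ × e' ⊏∈ E → Σ (List S) λ L → e' ◀ L × (∀ h → h ∈ L → h ⊏∈ A₁ × h ⊏∈ A₂)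
      refine (_ , e , e∈E , e'⊏e) =
        let (e⊏w , c , c∈C , e⊏c) = All.lookup E-below e∈E
            (a₁ , a₁∈A₁ , c⊏a₁) = C⊏A₁ c c∈C
            (G , e◀G , G⊏A₂) = ⋘⇒◀⊏ (⊏-⋘-trans e⊏w w⋘A₂)
            (L , L-below , e'◀L) = loc e'⊏e e◀G
        in L , e'◀L , λ h m → let (h⊏e , g , g∈G , h⊏g) = All.lookup L-below m
                                  (a₂ , a₂∈A₂ , g⊏a₂) = G⊏A₂ g g∈G
                              in (a₁ , a₁∈A₁ , ⊏-idem₂ h⊏e (⊏-idem₂ e⊏c c⊏a₁)) , (a₂ , a₂∈A₂ , ⊏-idem₂ h⊏g g⊏a₂)

    ≤-◁ : ∀ {a b U} → a ≤ b → U b → a ◁ U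
    ≤-◁ {U = U} a≤b Ub = ◁-mono a≤b (λ u u≡b → subst U (sym u≡b) Ub)

    ≤-◁-trans : ∀ {a b U} → a ≤ b → b ◁ U → a ◁ U
    ≤-◁-trans {U = U} a≤b b◁U = ◁-trans a≤b (λ u u≡b → subst (_◁ U) (sym u≡b) b◁U)

    ⊏⇒≤ : ∀ {a b} → a ⊏ b → a ≤ b
    ⊏⇒≤ = ⊏⇒◁

    ⋘-singleton⇒≤ : ∀ {d a} → d ⋘ [ a ] → d ≤ a
    ⋘-singleton⇒≤ d⋘a = ◁-mono (⋘⇒◁ d⋘a) (λ u → ∈-singleton⁻)

    ◁-meet : ∀ {a U V} → a ◁ U → a ◁ V → a ◁ (U ⊓ V)
    ◁-meet a◁U a◁V b b⊏a =
      let (b₁ , b⊏b₁ , b₁⊏a) = ⊏-idem₁ b⊏a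
          (b₂ , b₁⊏b₂ , b₂⊏a) = ⊏-idem₁ b₁⊏a
          (A₁ , A₁⊆U , b₂⋘A₁) = a◁U b₂ b₂⊏a
          (A₂ , A₂⊆V , b₂⋘A₂) = a◁V b₂ b₂⊏a
          (H , b₁◀H , H-below) = ⋘-meet b₁⊏b₂ b₂⋘A₁ b₂⋘A₂
      in H , (λ h m → let ((a₁ , a₁∈A₁ , h⊏a₁) , (a₂ , a₂∈A₂ , h⊏a₂)) = H-below h m
                      in (a₁ , A₁⊆U a₁ a₁∈A₁ , ⊏⇒≤ h⊏a₁) , (a₂ , A₂⊆V a₂ a₂∈A₂ , ⊏⇒≤ h⊏a₂))
           , (b₁ , b⊏b₁ , b₁◀H)

formalTopology : LSCFC → FTop
formalTopology (X , loc) = record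
  { bcov = basicCover X
  ; _≤_ = _≤_
  ; ≤-refl = ◁-refl refl
  ; ≤-trans = ≤-◁-trans
  ; ≤⇒◁ = λ a≤b → a≤b
  ; ◁-meet = ◁-meet
  }
  where
  open StrongContinuousFinitaryCover X
  open LocalizedCover X loc

locallyCompactFormalTopology : LSCFC → LKFT
locallyCompactFormalTopology X =
  record { ftop = formalTopology X ; cont = CBC.cont (contBasicCover (proj₁ X)) }

module ProximityMap (X Y : LSCFC) (r : FRel (proj₁ X) (proj₁ Y))
  (ja : IsJoinApprox (proj₁ X) (proj₁ Y) r) (law : IsLawson (proj₁ X) (proj₁ Y) r) where
  open StrongContinuousFinitaryCover (proj₁ X)
  open LocalizedCover (proj₁ X) (proj₂ X)
  module Y = LocalizedCover (proj₁ Y) (proj₂ Y)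
  module R = JoinApproximable (proj₁ X) (proj₁ Y) r ja
  private
    Fr = coverMap (proj₁ X) (proj₁ Y) r
    ↓ = λ (y : R.Y.S) → down (formalTopology Y) (_≡ y)

  opaque
    ◁-pre-⊤ : ∀ a → a ◁ pre Fr (λ _ → ⊤)
    ◁-pre-⊤ a = ◁-trans (◁-⊏ a) λ b b⊏a → R.r⇒◁pre (proj₂ (proj₁ law b a b⊏a)) (λ _ _ → tt)

    -- Lawson condition (ii) provides, below h, points way below both [a] and [b].
    r-meet-◁ : ∀ {h a b} → r h [ a ] → r h [ b ] → h ◁ pre Fr (λ y → ↓ a y × ↓ b y)
    r-meet-◁ {h} {a} {b} hra hrb k k⊏h =
      let (D , D-below , krD) = proj₂ law k h [ a ] [ b ] k⊏h hra hrb
          (A , k⋘A , A-r) = R.r-split-⋘ krD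
      in A , (λ t m → let (δ , δ∈D , trδ) = A-r t m
                          (δ⋘a , δ⋘b) = D-below δ δ∈D
                      in δ , ((a , refl , Y.⋘-singleton⇒≤ δ⋘a) , (b , refl , Y.⋘-singleton⇒≤ δ⋘b)) , ◁-refl trδ)
           , k⋘A

    ◁-r-meet : ∀ {x a b} → x ◁ (λ c → r c [ a ]) → x ◁ (λ c → r c [ b ]) → x ◁ pre Fr (λ y → ↓ a y × ↓ b y)
    ◁-r-meet {x} x◁ra x◁rb = ◁-trans (◁-⊏ x) λ e e⊏x →
      let (e₂ , e⊏e₂ , e₂⊏x) = ⊏-idem₁ e⊏x
          (A₁ , A₁-r , e₂⋘A₁) = x◁ra e₂ e₂⊏x
          (A₂ , A₂-r , e₂⋘A₂) = x◁rb e₂ e₂⊏x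
          (H , e◀H , H-below) = ⋘-meet e⊏e₂ e₂⋘A₁ e₂⋘A₂
      in ◁-trans (◀⇒◁ e◀H) λ h m →
           let ((a₁ , a₁∈A₁ , h⊏a₁) , (a₂ , a₂∈A₂ , h⊏a₂)) = H-below h m
           in r-meet-◁ (R.r-⊏-down h⊏a₁ (A₁-r a₁ a₁∈A₁)) (R.r-⊏-down h⊏a₂ (A₂-r a₂ a₂∈A₂))

    coverMap-isFTMap : IsFTMap (formalTopology X) (formalTopology Y) Fr
    coverMap-isFTMap =
        R.coverMap-isBCMap
      , ◁-pre-⊤
      , λ a b x (u , ura , x≤u) (v , vrb , x≤v) → ◁-r-meet (≤-◁-trans x≤u ura) (≤-◁-trans x≤v vrb)

module LocallyCompactFormalTopology (Y : LKFT) where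
  open ContinuousBasicCover (forget₀ Y) public
  open FTop (LKFT.ftop Y) public using (_≤_; ≤⇒◁; ◁-meet)

  _⊓_ : (S → Set) → (S → Set) → S → Set
  U ⊓ V = U ⊓⟨ _≤_ ⟩ V

  opaque
    ≤-◁-trans : ∀ {a b U} → a ≤ b → b ◁ U → a ◁ U
    ≤-◁-trans {U = U} a≤b b◁U = ◁-trans (≤⇒◁ a≤b) (λ u u≡b → subst (_◁ U) (sym u≡b) b◁U)

    ≤-◁ : ∀ {a b U} → a ≤ b → U b → a ◁ U
    ≤-◁ a≤b Ub = ≤-◁-trans a≤b (◁-refl Ub)

finitaryCover-localized : (Y : LKFT) → Localized (finitaryCover (forget₀ Y))
finitaryCover-localized Y {A₀} {B₀} {𝓐} B₀⋐A₀ A₀◁𝓐 =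
  let (Z , B₀◁Z , Z⊆⇊) = ⋐-⇊-finite (⋐-◁-trans B₀⋐A₀ (λ a a∈A₀ → ◁-meet (◁-refl a∈A₀) (A₀◁𝓐 a a∈A₀)))
  in singletons Z
     , All.tabulate (λ {C} → singletons-∀ {P = λ C → C ⋐ (_∈ A₀) × Σ (List S) λ A' → A' ∈ 𝓐 × C ⋐ (_∈ A')}
         (λ z z∈Z →
         let (x , ((u , u∈A₀ , x≤u) , (v , (A' , A'∈𝓐 , v∈A') , x≤v)) , z≪x) = Z⊆⇊ z z∈Z
         in wb-◁⇒[]⋐ z≪x (≤-◁ x≤u u∈A₀) , A' , A'∈𝓐 , wb-◁⇒[]⋐ z≪x (≤-◁ x≤v v∈A')) C)
     , ◁*-trans B₀◁Z (λ u m → ◁-refl (⋃-singletons⁺ m))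
  where open LocallyCompactFormalTopology Y

localizedFinitaryCover : LKFT → LSCFC
localizedFinitaryCover Y = finitaryCover (forget₀ Y) , finitaryCover-localized Y

module FormalTopologyMap (X Y : LKFT) (r : BRel (FTop.bcov (LKFT.ftop X)) (FTop.bcov (LKFT.ftop Y)))
  (ft : IsFTMap (LKFT.ftop X) (LKFT.ftop Y) r) where
  open LocallyCompactFormalTopology X
  module Y = LocallyCompactFormalTopology Y
  module R = BasicCoverMap (forget₀ X) (forget₀ Y) r (proj₁ ft)
  private
    GY = finitaryCover (forget₀ Y)
    Gr = finitaryMap (forget₀ X) (forget₀ Y) r

  opaque
    Gr-total : ∀ A A' → A ⋐ (_∈ A') → Σ (List (List Y.S)) λ 𝓑 → Gr A 𝓑
    Gr-total A A' A⋐A' =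
      let (Z , _ , A⋐rZ) = R.⋐-pre-finite (⋐-◁-trans A⋐A' (λ u _ → proj₁ (proj₂ ft) u))
      in [ Z ] , ⋐-◁-trans A⋐rZ (λ u (y , y∈Z , ury) → ◁-refl (y , (Z , here refl , y∈Z) , ury))

    Gr-⊓ : ∀ {A' 𝓑 𝓒} → Gr A' 𝓑 → Gr A' 𝓒 → A' ◁* pre r (⋃ᴸ 𝓑 Y.⊓ ⋃ᴸ 𝓒)
    Gr-⊓ {A'} {𝓑} {𝓒} A'r𝓑 A'r𝓒 a' m = ◁-trans (◁-meet (⋐⇒◁* A'r𝓑 a' m) (⋐⇒◁* A'r𝓒 a' m)) λ
      { x ((u , (y₁ , 𝓑y₁ , ury₁) , x≤u) , (v , (y₂ , 𝓒y₂ , vry₂) , x≤v)) →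
          ◁-mono (proj₂ (proj₂ ft) y₁ y₂ x (u , ury₁ , x≤u) (v , vry₂ , x≤v))
            λ { t (y , ((_ , refl , y≤y₁) , (_ , refl , y≤y₂)) , try) →
                  y , ((y₁ , 𝓑y₁ , y≤y₁) , (y₂ , 𝓒y₂ , y≤y₂)) , try } }

    Gr-meet : ∀ A A' 𝓑 𝓒 → A ⋐ (_∈ A') → Gr A' 𝓑 → Gr A' 𝓒 →
      Σ (List (List Y.S)) λ 𝓓 → (∀ D → D ∈ 𝓓 → ≪ GY D 𝓑 × ≪ GY D 𝓒) × Gr A 𝓓
    Gr-meet A A' 𝓑 𝓒 A⋐A' A'r𝓑 A'r𝓒 =
      let (Z , Z⊆⇊ , A⋐rZ) = R.⋐-pre-⇊-finite (⋐-◁-trans A⋐A' (Gr-⊓ A'r𝓑 A'r𝓒))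
      in singletons Z
         , singletons-∀ (λ z z∈Z →
             let (y , ((y₁ , (B , B∈𝓑 , y₁∈B) , y≤y₁) , (y₂ , (C , C∈𝓒 , y₂∈C) , y≤y₂)) , z≪y) = Z⊆⇊ z z∈Z
             in ([ y₁ ] , Y.wb-◁⇒[]⋐ z≪y (Y.≤-◁ y≤y₁ (here refl)) , singleton◁ B∈𝓑 y₁∈B)
              , ([ y₂ ] , Y.wb-◁⇒[]⋐ z≪y (Y.≤-◁ y≤y₂ (here refl)) , singleton◁ C∈𝓒 y₂∈C))
         , R.⋐-pre-singletons A⋐rZ
      where
      singleton◁ : ∀ {B 𝓑 y} → B ∈ 𝓑 → y ∈ B → [ y ] Y.◁* ⋃ᴸ 𝓑
      singleton◁ B∈𝓑 y∈B u m = Y.◁-refl (_ , B∈𝓑 , subst (_∈ _) (sym (∈-singleton⁻ m)) y∈B)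

    finitaryMap-isLawson : IsLawson (finitaryCover (forget₀ X)) GY Gr
    finitaryMap-isLawson = Gr-total , Gr-meet

module UnitProximity (X : LSCFC) where
  open StrongContinuousFinitaryCover (proj₁ X)
  open LocalizedCover (proj₁ X) (proj₂ X)
  module F = ContinuousBasicCover (contBasicCover (proj₁ X))
  open F using (_⋐_; ⋐-◁-trans; ⋐⇒◁*; ⋐-interpolate; wb-◁⇒[]⋐)
  private
    GF = finitaryCover (contBasicCover (proj₁ X))
    α = η-to (proj₁ X)
    β = η-from (proj₁ X)

  opaque
    α-total : ∀ a a' → a ⊏ a' → Σ (List (List S)) λ 𝓑 → α a 𝓑
    α-total a a' a⊏a' = [ [ a' ] ] , (a' , a⊏a' , ◁-refl ([ a' ] , here refl , here refl))

    α-meet : ∀ a a' 𝓑 𝓒 → a ⊏ a' → α a' 𝓑 → α a' 𝓒 →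
      Σ (List (List S)) λ 𝓓 → (∀ D → D ∈ 𝓓 → ≪ GF D 𝓑 × ≪ GF D 𝓒) × α a 𝓓
    α-meet a a' 𝓑 𝓒 a⊏a' (a₁ , a'⊏a₁ , a₁◁𝓑) (a₂ , a'⊏a₂ , a₂◁𝓒) =
      let (b , Z , a⊏b , b◁Z , Z⊆⇊) = Unit.⊏-◁-⇊-finite (proj₁ X) a⊏a'
                                        (◁-meet (⊏-◁-trans a'⊏a₁ a₁◁𝓑) (⊏-◁-trans a'⊏a₂ a₂◁𝓒))
      in singletons Z
         , singletons-∀ (λ z z∈Z →
             let (y , ((u , (B , B∈𝓑 , u∈B) , y≤u) , (v , (C , C∈𝓒 , v∈C) , y≤v)) , z⊏y) = Z⊆⇊ z z∈Z
             in ([ u ] , wb-◁⇒[]⋐ z⊏y (≤-◁ y≤u (here refl)) , singleton◁ B∈𝓑 u∈B)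
              , ([ v ] , wb-◁⇒[]⋐ z⊏y (≤-◁ y≤v (here refl)) , singleton◁ C∈𝓒 v∈C))
         , (b , a⊏b , ◁-mono b◁Z (λ u → ⋃-singletons⁺))
      where
      singleton◁ : ∀ {B 𝓑 y} → B ∈ 𝓑 → y ∈ B → [ y ] F.◁* ⋃ᴸ 𝓑
      singleton◁ B∈𝓑 y∈B u m = ◁-refl (_ , B∈𝓑 , subst (_∈ _) (sym (∈-singleton⁻ m)) y∈B)

    η-to-isLawson : IsLawson (proj₁ X) GF α
    η-to-isLawson = α-total , α-meet

    β-meet : ∀ A A' B C → A ⋐ (_∈ A') → β A' B → β A' C →
      Σ (List S) λ D → (∀ d → d ∈ D → d ⋘ B × d ⋘ C) × β A D
    β-meet A A' B C A⋐A' A'⋐B A'⋐C =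
      let (D₁ , A⋐D₁ , (D , D₁◁D , D⊏⊓)) =
            ⋐-interpolate (⋐-◁-trans A⋐A' (λ a' m → ◁-meet (⋐⇒◁* A'⋐B a' m) (⋐⇒◁* A'⋐C a' m)))
      in D , (λ d m → let (c , d⊏c , c◁⊓) = D⊏⊓ d m
                          (A'' , A''⊆⊓ , d⋘A'') = c◁⊓ d d⊏c
                          (C₁ , C₁⊆B , d⋘C₁) = ⋘-◁-choice d⋘A'' λ x x∈A'' →
                            let ((u , u∈B , x≤u) , _) = A''⊆⊓ x x∈A'' in ≤-◁ x≤u u∈B
                          (C₂ , C₂⊆C , d⋘C₂) = ⋘-◁-choice d⋘A'' λ x x∈A'' →
                            let (_ , (v , v∈C , x≤v)) = A''⊆⊓ x x∈A'' in ≤-◁ x≤v v∈C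
                      in ⋘-mono d⋘C₁ (C₁⊆B _) , ⋘-mono d⋘C₂ (C₂⊆C _))
           , ⋐-◁-trans A⋐D₁ D₁◁D

    η-from-isLawson : IsLawson GF (proj₁ X) β
    η-from-isLawson = (λ A A' A⋐A' → A' , A⋐A') , β-meet

module CounitFormalTopology (Y : LKFT) where
  open LocallyCompactFormalTopology Y
  module C = Counit (forget₀ Y)
  module G = LocalizedCover (finitaryCover (forget₀ Y)) (finitaryCover-localized Y)
  private
    Y' = forget₀ Y
    α = ε-to Y'
    β = ε-from Y'

  opaque
    ≤-ε-to : ∀ {A U y} → A G.≤ U → α U y → α A y
    ≤-ε-to A≤U U-y = ◁*-trans (C.G◁⇒◁*-⋃ A≤U) (λ x (U' , U'≡U , x∈U') → U-y x (subst (_ ∈_) U'≡U x∈U'))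

    ε-to-isFTMap : IsFTMap (formalTopology (localizedFinitaryCover Y)) (LKFT.ftop Y) α
    ε-to-isFTMap =
        C.ε-to-isBCMap
      , (λ A → C.◁*-⋃⇒G◁ (λ a _ → C.◁-⋃-pre-ε-to tt))
      , λ y₁ y₂ A (U , U-y₁ , A≤U) (V , V-y₂ , A≤V) → C.◁*-⋃⇒G◁ λ x m →
          ◁-trans (◁-meet (≤-ε-to A≤U U-y₁ x m) (≤-ε-to A≤V V-y₂ x m)) (λ w ↓y₁↓y₂ → C.◁-⋃-pre-ε-to ↓y₁↓y₂)

    ≤⇒singleton-≤ : ∀ {m b B} → m ≤ b → b ∈ B → [ m ] G.≤ B
    ≤⇒singleton-≤ {b = b} {B} m≤b b∈B = C.◁*-⋃⇒G◁ λ t t∈[m] →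
      ◁-mono (subst (_◁ (_≡ b)) (sym (∈-singleton⁻ t∈[m])) (≤⇒◁ m≤b))
             (λ s s≡b → B , refl , subst (_∈ B) (sym s≡b) b∈B)

    ε-from-isFTMap : IsFTMap (LKFT.ftop Y) (formalTopology (localizedFinitaryCover Y)) β
    ε-from-isFTMap =
        C.ε-from-isBCMap
      , (λ y → ◁-refl ([ y ] , tt , ◁-refl (here refl)))
      , λ B₁ B₂ x (u , u◁B₁ , x≤u) (v , v◁B₂ , x≤v) →
          ◁-trans (◁-meet (≤-◁-trans x≤u u◁B₁) (≤-◁-trans x≤v v◁B₂))
            λ { m ((b₁ , b₁∈B₁ , m≤b₁) , (b₂ , b₂∈B₂ , m≤b₂)) →
                  ◁-refl ([ m ] , ((B₁ , refl , ≤⇒singleton-≤ m≤b₁ b₁∈B₁) , (B₂ , refl , ≤⇒singleton-≤ m≤b₂ b₂∈B₂))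
                         , ◁-refl (here refl)) }

module _ (X Y : BCov) where
  private
    module X = BCov X
    module Y = BCov Y

  opaque
    idB-*ˡ : (r : BRel X Y) → IsBCMap X Y r → _≈B_ {X} {Y} (_*_ {X} {Y} {Y} (idB Y) r) r
    idB-*ˡ r (saturated , continuous) a b =
        (λ a◁r⁻b → saturated a b (X.◁-trans a◁r⁻b λ x (y , y◁b , xry) →
           X.◁-trans (continuous y (_≡ b) y◁b x xry)
             (λ x' (b' , b'≡b , x'rb') → X.◁-refl (subst (r x') b'≡b x'rb'))))
      , (λ arb → X.◁-refl (b , Y.◁-refl refl , arb))

    idB-*ʳ : (r : BRel X Y) → IsBCMap X Y r → _≈B_ {X} {Y} (_*_ {X} {X} {Y} r (idB X)) r
    idB-*ʳ r (saturated , _) a b =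
        (λ a◁x → saturated a b (X.◁-trans a◁x λ x (y , yrb , x◁y) →
           X.◁-trans x◁y (λ x' x'≡y → X.◁-refl (subst (λ t → r t b) (sym x'≡y) yrb))))
      , (λ arb → X.◁-refl (a , arb , X.◁-refl refl))

opaque
  idB-isBCMap : (X : BCov) → IsBCMap X X (idB X)
  idB-isBCMap X =
      (λ a b a◁b → ◁-trans a◁b (λ u q → q))
    , (λ b V b◁V a a◁b → ◁-trans a◁b λ u u≡b →
         ◁-trans (subst (_◁ V) (sym u≡b) b◁V) (λ v Vv → ◁-refl (v , Vv , ◁-refl refl)))
    where open BCov X

  ≪-isJoinApprox : (X : SCFC) → IsJoinApprox X X (≪ X)
  ≪-isJoinApprox X =
      (λ a C → ≪·≪⇒≪ , ≪⇒≪·≪)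
    , (λ a C → ≪·≪⇒≪ , ≪⇒≪·≪)
    , (λ a B a⋘B → let (A , a◀A , A⊏B) = ⋘⇒◀⊏ a⋘B in
         A , a◀A , λ a' m → let (c , c∈B , a'⊏c) = A⊏B a' m in c , c∈B , ⊏⇒⋘ a'⊏c (here refl))
    where
    open StrongContinuousFinitaryCover X
    ≪·≪⇒≪ : ∀ {a C} → _·_ {X} {X} {X} (≪ X) (≪ X) a C → a ⋘ C
    ≪·≪⇒≪ (B , a⋘B , B⋘C) = ⋘-trans a⋘B B⋘C
    ≪⇒≪·≪ : ∀ {a C} → a ⋘ C → _·_ {X} {X} {X} (≪ X) (≪ X) a C
    ≪⇒≪·≪ a⋘C = let (a₁ , a⊏a₁ , a₁⋘C) = ⋘-interpolate a⋘C in
      [ a₁ ] , ⊏⇒⋘ a⊏a₁ (here refl) , λ { _ (here refl) → a₁⋘C }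

formalTopologyFunctor : Functor LSContFCov LKFTop
formalTopologyFunctor = record
  { F₀ = locallyCompactFormalTopology
  ; F₁ = λ {X} {Y} r _ → coverMap (proj₁ X) (proj₁ Y) r
  ; F-hom = λ {X} {Y} r p → ProximityMap.coverMap-isFTMap X Y r (proj₁ (lower p)) (proj₂ (lower p))
  ; F-resp = λ {X} {Y} {r} {r'} _ _ → coverMap-resp (proj₁ X) (proj₁ Y) r r'
  ; F-id = λ X _ → coverMap-id (proj₁ X)
  ; F-∘ = λ {X} {Y} {Z} r s p _ _ → coverMap-∘ (proj₁ X) (proj₁ Y) (proj₁ Z) r s (proj₁ (lower p))
  }

localizedFinitaryFunctor : Functor LKFTop LSContFCov
localizedFinitaryFunctor = record
  { F₀ = localizedFinitaryCover
  ; F₁ = λ {X} {Y} r _ → finitaryMap (forget₀ X) (forget₀ Y) r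
  ; F-hom = λ {X} {Y} r p → lift ( BasicCoverMap.finitaryMap-isJoinApprox (forget₀ X) (forget₀ Y) r (proj₁ p)
                                 , FormalTopologyMap.finitaryMap-isLawson X Y r p)
  ; F-resp = λ {X} {Y} {r} {r'} _ _ → finitaryMap-resp (forget₀ X) (forget₀ Y) r r'
  ; F-id = λ X _ → finitaryMap-id (forget₀ X)
  ; F-∘ = λ {X} {Y} {Z} r s p _ _ → finitaryMap-∘ (forget₀ X) (forget₀ Y) (forget₀ Z) r s (proj₁ p)
  }

LSContFCov≃LKFTop : Equivalence LSContFCov LKFTop
LSContFCov≃LKFTop = record
  { F = formalTopologyFunctor
  ; G = localizedFinitaryFunctor
  ; η = record
    { α = λ X → η-to (proj₁ X)
    ; α-hom = λ X → lift (Unit.η-to-isJoinApprox (proj₁ X) , UnitProximity.η-to-isLawson X)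
    ; β = λ X → η-from (proj₁ X)
    ; β-hom = λ X → lift (Unit.η-from-isJoinApprox (proj₁ X) , UnitProximity.η-from-isLawson X)
    ; βα = λ X _ _ → Unit.β·α⇒≪ (proj₁ X) , Unit.≪⇒β·α (proj₁ X)
    ; αβ = λ X _ _ → Unit.α·β⇒≪ (proj₁ X) , Unit.≪⇒α·β (proj₁ X)
    ; nat = λ {X} {Y} r p → UnitNatural.η-to-natural (proj₁ X) (proj₁ Y) r (proj₁ (lower p))
    }
  ; ε = record
    { α = λ Y → ε-to (forget₀ Y)
    ; α-hom = CounitFormalTopology.ε-to-isFTMap
    ; β = λ Y → ε-from (forget₀ Y)
    ; β-hom = CounitFormalTopology.ε-from-isFTMap
    ; βα = λ Y _ _ → Counit.β*α⇒id (forget₀ Y) , Counit.id⇒β*α (forget₀ Y)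
    ; αβ = λ Y _ _ → Counit.α*β⇒id (forget₀ Y) , Counit.id⇒α*β (forget₀ Y)
    ; nat = λ {X} {Y} r p → CounitNatural.ε-to-natural (forget₀ X) (forget₀ Y) r (proj₁ p)
    }
  }

-- The localized functors agree with the general ones on objects and relations, so the comparison
-- isomorphisms are the identity morphisms.
restricts : Restricts SContFCov≃ContBCov LSContFCov≃LKFTop
restricts = coverFunctor-restricts , finitaryFunctor-restricts
  where
  coverFunctor-restricts : NatIso LSContFCov ContBCov
    (λ X → forget₀ (locallyCompactFormalTopology X)) (λ X → contBasicCover (proj₁ X))
    (λ {X} {Y} r _ → coverMap (proj₁ X) (proj₁ Y) r) (λ {X} {Y} r _ → coverMap (proj₁ X) (proj₁ Y) r)
  coverFunctor-restricts = record
    { α = λ X → idB (basicCover (proj₁ X))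
    ; α-hom = λ X → idB-isBCMap (basicCover (proj₁ X))
    ; β = λ X → idB (basicCover (proj₁ X))
    ; β-hom = λ X → idB-isBCMap (basicCover (proj₁ X))
    ; βα = λ X → let B = basicCover (proj₁ X) in idB-*ˡ B B (idB B) (idB-isBCMap B)
    ; αβ = λ X → let B = basicCover (proj₁ X) in idB-*ˡ B B (idB B) (idB-isBCMap B)
    ; nat = λ {X} {Y} r p a b →
        let Fr-hom = JoinApproximable.coverMap-isBCMap (proj₁ X) (proj₁ Y) r (proj₁ (lower p))
            Fr = coverMap (proj₁ X) (proj₁ Y) r
            (l⇒ , l⇐) = idB-*ˡ (basicCover (proj₁ X)) (basicCover (proj₁ Y)) Fr Fr-hom a b
            (r⇒ , r⇐) = idB-*ʳ (basicCover (proj₁ X)) (basicCover (proj₁ Y)) Fr Fr-hom a b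
        in (λ q → r⇐ (l⇒ q)) , (λ q → l⇐ (r⇒ q))
    }
  finitaryFunctor-restricts : NatIso LKFTop SContFCov
    (λ Y → finitaryCover (forget₀ Y)) (λ Y → finitaryCover (forget₀ Y))
    (λ {X} {Y} r _ → finitaryMap (forget₀ X) (forget₀ Y) r) (λ {X} {Y} r _ → finitaryMap (forget₀ X) (forget₀ Y) r)
  finitaryFunctor-restricts = record
    { α = λ Y → ≪ (finitaryCover (forget₀ Y))
    ; α-hom = λ Y → lift (≪-isJoinApprox (finitaryCover (forget₀ Y)))
    ; β = λ Y → ≪ (finitaryCover (forget₀ Y))
    ; β-hom = λ Y → lift (≪-isJoinApprox (finitaryCover (forget₀ Y)))
    ; βα = λ Y → proj₁ (≪-isJoinApprox (finitaryCover (forget₀ Y)))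
    ; αβ = λ Y → proj₁ (≪-isJoinApprox (finitaryCover (forget₀ Y)))
    ; nat = λ {X} {Y} r p A 𝓒 →
        let Gr-ja = BasicCoverMap.finitaryMap-isJoinApprox (forget₀ X) (forget₀ Y) r (proj₁ p)
            (pre⇒ , pre⇐) = proj₁ Gr-ja A 𝓒
            (post⇒ , post⇐) = proj₁ (proj₂ Gr-ja) A 𝓒
        in (λ q → pre⇐ (post⇒ q)) , (λ q → post⇐ (pre⇒ q))
    }

theorem4p36 : Σ (Equivalence SContFCov ContBCov) (λ E₁ →
                Σ (Equivalence LSContFCov LKFTop) (λ E₂ → Restricts E₁ E₂))
theorem4p36 = SContFCov≃ContBCov , LSContFCov≃LKFTop , restricts
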